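{- Let $\lambda_\subset$ be the inverse of the character $\lambda_0$ (with $\lambda_0(G)=1$ for every hypergraph $G$) for the convolution product $\star_\subset$. Then for every hypergraph $G$, $\lambda_\subset(G)=\sum_{j\geq0}(-1)^jN_G(\mathrm{cc}(G),j)$.
   Context: $\mathbb{K}$ is a field of characteristic zero. A hypergraph is a pair $G=(V(G),E(G))$ with $V(G)$ finite and $E(G)\subseteq\mathcal{P}(V(G))$ containing $\emptyset$ and all singletons; $E^+(G)=\{e\in E(G)\mid|e|\geq2\}$. A path is a sequence of vertices with consecutive ones in a common edge; $\mathrm{cc}(G)$ is the number of connected components. For $I\subseteq V(G)$, $G_{\mid_\subset I}$ has vertex set $I$ and edges $\{e\in E(G)\mid e\subseteq I\}$. For an equivalence $\sim$ on $V(G)$ with canonical surjection $\pi_\sim$: $G/\sim$ has vertex set $V(G)/\sim$ and edges $\{\pi_\sim(e)\mid e\in E(G)\}$; $G\mid_\subset\sim=\prod_{C\in V(G)/\sim}G_{\mid_\subset C}$ (disjoint union); $\mathcal{E}_\subset[G]$ is the set of equivalences such that each $G_{\mid_\subset C}$, $C$ a class, is connected. $\mathcal{F}[\mathbf{H}]$ is the $\mathbb{K}$-algebra with basis the isomorphism classes of hypergraphs and product the disjoint union; characters are algebra morphisms to $\mathbb{K}$, and $(\zeta\star_\subset\zeta')(G)=\sum_{\sim\in\mathcal{E}_\subset[G]}\zeta(G/\sim)\zeta'(G\mid_\subset\sim)$, with unit $\epsilon_\delta$ ($\epsilon_\delta(G)=1$ if $E^+(G)=\emptyset$, else $0$). For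 $i,j\geq0$, $N_G(i,j)$ is the number of hypergraphs $G'$ with $V(G')=V(G)$, $E^+(G')\subseteq E^+(G)$, $\mathrm{cc}(G')=i$ and $|E^+(G')|=j$. -}

module Defs where

open import Level using (Level; _⊔_)
open import Data.Nat as ℕ using (ℕ; zero; suc; _≤ᵇ_; _≡ᵇ_)
open import Data.Bool as B using (Bool; true; false; _∧_; _∨_)
open import Data.Fin as F using (Fin; zero; suc)
open import Data.Fin.Properties using (any?; all?; _<?_)
open import Data.Fin.Subset using (Subset; inside; outside; _∈_; ∣_∣)
open import Data.Fin.Subset.Properties using (_∈?_; anySubset?)
open import Data.Vec as Vec using (Vec; []; _∷_)
open import Data.Vec.Properties using (≡-dec)
open import Data.List as List using (List; []; _∷_; [_]; _++_; map; concatMap; filter; length; foldr; allFin; upTo)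
open import Data.List.Relation.Unary.Any as Any using ()
open import Data.Product using (Σ; ∃; _×_; _,_)
open import Data.Sum using (_⊎_; inj₁; inj₂)
open import Relation.Nullary using (¬_; Dec; yes; no)
open import Relation.Nullary.Decidable using (⌊_⌋; _×-dec_; _⊎-dec_; _→-dec_; ¬?; map′)
open import Relation.Binary using (Rel; Decidable)
open import Relation.Binary.PropositionalEquality using (_≡_; refl)
open import Relation.Binary.Construct.Closure.ReflexiveTransitive using (Star; ε; _◅_; _◅◅_)
open import Function.Bundles using (_↔_; Inverse)
open import Algebra.Bundles using (CommutativeRing)

-- Hypergraphs.  The vertex set is Fin size.  The edge set is
--   E(G) = { S | rawEdge S = true } ∪ { S | ∣ S ∣ ≤ 1 },
-- so that ∅ and all singletons are always edges (as required in the paper).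

record Hypergraph : Set where
  constructor hg
  field
    size    : ℕ
    rawEdge : Subset size → Bool

open Hypergraph public

edge : (G : Hypergraph) → Subset (size G) → Bool
edge G S = rawEdge G S ∨ (∣ S ∣ ≤ᵇ 1)

edge⁺ : (G : Hypergraph) → Subset (size G) → Bool
edge⁺ G S = edge G S ∧ (2 ≤ᵇ ∣ S ∣)

image : ∀ {n k} → (Fin n → Fin k) → Subset n → Subset k
image π S = Vec.tabulate (λ c → ⌊ any? (λ j → (j ∈? S) ×-dec (π j F.≟ c)) ⌋)

_≟ˢ_ : ∀ {n} → (S T : Subset n) → Dec (S ≡ T)
_≟ˢ_ = ≡-dec B._≟_

record _≅_ (G H : Hypergraph) : Set where
  field
    bij  : Fin (size G) ↔ Fin (size H)
    pres : ∀ S → edge H (image (Inverse.to bij) S) ≡ edge G S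

∅ᴴ : Hypergraph
∅ᴴ = hg 0 (λ _ → false)

isEmptySet : ∀ {n} → Subset n → Bool
isEmptySet S = ∣ S ∣ ≡ᵇ 0

-- disjoint union (the product of F[H]); vertices of G come first
_⊔ᴴ_ : Hypergraph → Hypergraph → Hypergraph
G ⊔ᴴ H = hg (size G ℕ.+ size H)
  (λ S → (edge G (Vec.take (size G) S) ∧ isEmptySet (Vec.drop (size G) S))
       ∨ (isEmptySet (Vec.take (size G) S) ∧ edge H (Vec.drop (size G) S)))

Adj : (G : Hypergraph) → Rel (Fin (size G)) Level.zero
Adj G i j = ∃ λ e → edge G e ≡ true × i ∈ e × j ∈ e

Connected : (G : Hypergraph) → Rel (Fin (size G)) Level.zero
Connected G = Star (Adj G)

adj? : (G : Hypergraph) → Decidable (Adj G)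
adj? G i j = anySubset? (λ e → (edge G e B.≟ true) ×-dec (i ∈? e) ×-dec (j ∈? e))

-- decidability of reachability on a finite vertex set (by vertex elimination)
elimR : ∀ {n ℓ} → Rel (Fin (suc n)) ℓ → Rel (Fin n) ℓ
elimR R a b = R (suc a) (suc b) ⊎ (R (suc a) zero × R zero (suc b))

module Elim {n ℓ} (R : Rel (Fin (suc n)) ℓ) where
  go₁ : ∀ {a b} → Star R (suc a) (suc b) → Star (elimR R) a b
  go₂ : ∀ {a b} → R (suc a) zero → Star R zero (suc b) → Star (elimR R) a b
  go₁ ε = ε
  go₁ (_◅_ {j = zero} r p) = go₂ r p
  go₁ (_◅_ {j = suc c} r p) = inj₁ r ◅ go₁ p
  go₂ r (_◅_ {j = zero} r' p) = go₂ r p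
  go₂ r (_◅_ {j = suc c} r' p) = inj₂ (r , r') ◅ go₁ p

  back : ∀ {a b} → Star (elimR R) a b → Star R (suc a) (suc b)
  back ε = ε
  back (inj₁ r ◅ p) = r ◅ back p
  back (inj₂ (r , r') ◅ p) = r ◅ r' ◅ back p

  fromZero : ∀ {b} → Star R zero (suc b) → ∃ λ a → R zero (suc a) × Star (elimR R) a b
  fromZero (_◅_ {j = zero} r p) = fromZero p
  fromZero (_◅_ {j = suc a} r p) = a , r , go₁ p

  toZero : ∀ {a} → Star R (suc a) zero → ∃ λ c → Star (elimR R) a c × R (suc c) zero
  toZero (_◅_ {j = zero} r p) = _ , ε , r
  toZero (_◅_ {j = suc c} r p) with toZero p
  ... | d , q , r' = d , inj₁ r ◅ q , r'

star? : ∀ {n ℓ} {R : Rel (Fin n) ℓ} → Decidable R → Decidable (Star R)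
star? {zero} R? ()
star? {suc n} {R = R} R? = dec
  where
  open Elim R
  R'? : Decidable (elimR R)
  R'? a b = R? (suc a) (suc b) ⊎-dec (R? (suc a) zero ×-dec R? zero (suc b))
  dec : Decidable (Star R)
  dec zero zero = yes ε
  dec zero (suc b) = map′ (λ { (a , r , p) → r ◅ back p }) fromZero
                          (any? (λ a → R? zero (suc a) ×-dec star? R'? a b))
  dec (suc a) zero = map′ (λ { (c , p , r) → back p ◅◅ (r ◅ ε) }) toZero
                          (any? (λ c → star? R'? a c ×-dec R? (suc c) zero))
  dec (suc a) (suc b) = map′ back go₁ (star? R'? a b)

connected? : (G : Hypergraph) → Decidable (Connected G)
connected? G = star? (adj? G)

-- cc(G): number of connected components = number of vertices that are the
-- smallest vertex of their component
cc : Hypergraph → ℕ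
cc G = length (filter (λ i → all? (λ j → (j <? i) →-dec ¬? (connected? G j i))) (allFin (size G)))

-- Equivalence relations on V(G) = Fin n, encoded by their canonical
-- surjection π : Fin n → Fin k onto the classes, the classes being numbered
-- in order of their smallest element (restricted growth functions).

IsSurj : ∀ {n k} → (Fin n → Fin k) → Set
IsSurj π = ∀ c → ∃ λ i → π i ≡ c

IsCanonical : ∀ {n k} → (Fin n → Fin k) → Set
IsCanonical π = ∀ i c → c F.< π i → ∃ λ j → j F.< i × π j ≡ c

quot : (G : Hypergraph) {k : ℕ} → (Fin (size G) → Fin k) → Hypergraph
quot G {k} π = hg k (λ S → ⌊ anySubset? (λ e → (edge G e B.≟ true) ×-dec (image π e ≟ˢ S)) ⌋)

InOneClass : ∀ {n k} → (Fin n → Fin k) → Subset n → Set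
InOneClass π e = ∀ i j → i ∈ e → j ∈ e → π i ≡ π j

inOneClass? : ∀ {n k} (π : Fin n → Fin k) e → Dec (InOneClass π e)
inOneClass? π e = all? λ i → all? λ j → (i ∈? e) →-dec (j ∈? e) →-dec (π i F.≟ π j)

-- G |⊂ ∼ : disjoint union of the G|⊂C, C a class; realised on the vertex
-- set V(G) (canonically isomorphic to the disjoint union of the classes)
restr : (G : Hypergraph) {k : ℕ} → (Fin (size G) → Fin k) → Hypergraph
restr G π = hg (size G) (λ e → edge G e ∧ ⌊ inOneClass? π e ⌋)

-- every G|⊂C is connected: two vertices of the same class are joined by a
-- path in G|⊂C (equivalently in G|⊂∼, whose paths never leave a class)
ClassesConnected : (G : Hypergraph) {k : ℕ} → (Fin (size G) → Fin k) → Set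
ClassesConnected G π = ∀ i j → π i ≡ π j → Connected (restr G π) i j

Admissible : (G : Hypergraph) {k : ℕ} → (Fin (size G) → Fin k) → Set
Admissible G π = IsSurj π × IsCanonical π × ClassesConnected G π

admissible? : (G : Hypergraph) {k : ℕ} (π : Fin (size G) → Fin k) → Dec (Admissible G π)
admissible? G π =
  all? (λ c → any? (λ i → π i F.≟ c))
  ×-dec all? (λ i → all? (λ c → (c <? π i) →-dec any? (λ j → (j <? i) ×-dec (π j F.≟ c))))
  ×-dec all? (λ i → all? (λ j → (π i F.≟ π j) →-dec connected? (restr G π) i j))

allFuns : ∀ n k → List (Fin n → Fin k)
allFuns zero k = [ (λ ()) ]
allFuns (suc n) k =
  concatMap (λ c → map (λ f → λ { zero → c ; (suc i) → f i }) (allFuns n k)) (allFin k)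

module _ {c ℓ : Level} (K : CommutativeRing c ℓ) where
  open CommutativeRing K

  ∑ : List Carrier → Carrier
  ∑ = foldr _+_ 0#

  ℕ→K : ℕ → Carrier
  ℕ→K zero = 0#
  ℕ→K (suc m) = 1# + ℕ→K m

  sgn : ℕ → Carrier
  sgn zero = 1#
  sgn (suc j) = - 1# * sgn j

  record IsField : Set (c ⊔ ℓ) where
    field
      0≉1     : ¬ (0# ≈ 1#)
      inverse : ∀ x → ¬ (x ≈ 0#) → ∃ λ y → x * y ≈ 1#

  CharZero : Set ℓ
  CharZero = ∀ m → ℕ→K m ≈ 0# → m ≡ 0

  -- characters of F[H]: algebra morphisms F[H] → K, i.e. functions on
  -- isomorphism classes of hypergraphs, multiplicative for the disjoint
  -- union and sending the empty hypergraph to 1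
  record IsCharacter (ζ : Hypergraph → Carrier) : Set (c ⊔ ℓ) where
    field
      iso-inv : ∀ {G H} → G ≅ H → ζ G ≈ ζ H
      mult    : ∀ G H → ζ (G ⊔ᴴ H) ≈ ζ G * ζ H
      unit    : ζ ∅ᴴ ≈ 1#

  conv : (Hypergraph → Carrier) → (Hypergraph → Carrier) → Hypergraph → Carrier
  conv ζ ζ' G = ∑ (concatMap
    (λ k → map (λ π → ζ (quot G π) * ζ' (restr G π))
               (filter (admissible? G) (allFuns (size G) k)))
    (upTo (suc (size G))))

  λ₀ : Hypergraph → Carrier
  λ₀ G = 1#

  εδ : Hypergraph → Carrier
  εδ G with anySubset? (λ S → edge⁺ G S B.≟ true)
  ... | yes _ = 0#
  ... | no  _ = 1#

allSubsets : ∀ n → List (Subset n)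
allSubsets zero = [ [] ]
allSubsets (suc n) = concatMap (λ S → (inside ∷ S) ∷ (outside ∷ S) ∷ []) (allSubsets n)

edgeList⁺ : (G : Hypergraph) → List (Subset (size G))
edgeList⁺ G = filter (λ S → edge⁺ G S B.≟ true) (allSubsets (size G))

nEdges⁺ : Hypergraph → ℕ
nEdges⁺ G = length (edgeList⁺ G)

sublists : ∀ {a} {A : Set a} → List A → List (List A)
sublists [] = [ [] ]
sublists (x ∷ xs) = map (x ∷_) (sublists xs) ++ sublists xs

spanning : (G : Hypergraph) → List (Subset (size G)) → Hypergraph
spanning G F = hg (size G) (λ S → ⌊ Any.any? (S ≟ˢ_) F ⌋)

-- N_G(i,j): hypergraphs G' with V(G') = V(G), E⁺(G') ⊆ E⁺(G), cc(G') = i,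
-- |E⁺(G')| = j; such G' are determined by E⁺(G'), enumerated as the
-- sublists of edgeList⁺ G
N : Hypergraph → ℕ → ℕ → ℕ
N G i j = length (filter (λ F → (cc (spanning G F) ℕ.≟ i) ×-dec (nEdges⁺ (spanning G F) ℕ.≟ j))
                         (sublists (edgeList⁺ G)))

-- Σ_{j ≥ 0} (-1)^j N_G(cc(G), j)   (terms with j > |E⁺(G)| vanish)
altSum : ∀ {c ℓ} (K : CommutativeRing c ℓ) → Hypergraph → CommutativeRing.Carrier K
altSum K G = ∑ K (map (λ j → CommutativeRing._*_ K (sgn K j) (ℕ→K K (N G (cc G) j)))
                      (upTo (suc (nEdges⁺ G))))

-- Regrouped by j = |F|, the right-hand side is ψ(G) = Σ (-1)^|F| over the F ⊆ E⁺(G) with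
-- cc(V, F) = cc(G).  Expanding (λ₀ ⋆ ψ)(G) = Σ_∼ ψ(G|⊂∼) and exchanging the sums gives
-- Σ_F (-1)^|F| #{∼ ∈ E⊂[G] | F lies inside the classes, cc(V, F) = cc(G|⊂∼)}; the only such ∼ is
-- the partition into the components of (V, F), so (λ₀ ⋆ ψ)(G) = Σ_F (-1)^|F| = ε_δ(G).
-- In (λ₀ ⋆ ζ)(G), the partition into the components of G contributes ζ(G) and every other ∼
-- contributes ζ of a hypergraph with fewer edges, so λ₀ ⋆ λ⊂ = λ₀ ⋆ ψ forces λ⊂ = ψ by induction
-- on |E⁺(G)|.

module Submission where

open import Level using (Level)
open import Data.Nat as ℕ using (ℕ; zero; suc; _≤_; _<_; z≤n; s≤s; _≤ᵇ_)
import Data.Nat.Properties as ℕP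
open import Data.Bool as B using (Bool; true; false; _∧_; _∨_; not; T)
import Data.Bool.Properties as BP
open import Data.Fin as F using (Fin; zero; suc; toℕ; fromℕ<)
import Data.Fin.Properties as FP
open import Data.Fin.Subset using (Subset; inside; outside; ∣_∣) renaming (_∈_ to _∈ˢ_)
open import Data.Fin.Subset.Properties using (_∈?_; anySubset?)
open import Data.Vec as Vec using ([]; _∷_; here; there)
import Data.Vec.Properties as VP
open import Data.List as List using (List; []; _∷_; [_]; _++_; map; concatMap; filter; length; allFin; upTo)
import Data.List.Properties as LP
open import Data.List.Membership.Propositional using (_∈_)
open import Data.List.Membership.Propositional.Properties
  using (∈-allFin; ∈-upTo⁺; ∈-filter⁺; ∈-filter⁻; ∈-concatMap⁺; ∈-concatMap⁻; ∈-++⁻; ∈-map⁻)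
open import Data.List.Relation.Unary.Any as Any using (Any; here; there)
open import Data.List.Relation.Unary.All as All using (All; []; _∷_)
import Data.List.Relation.Unary.All.Properties as AllP
open import Data.List.Relation.Unary.AllPairs using ([]; _∷_)
open import Data.List.Relation.Unary.Unique.Propositional using (Unique)
open import Data.List.Relation.Binary.Sublist.Propositional using (_⊆_; []; _∷_; _∷ʳ_)
import Data.List.Relation.Binary.Sublist.Propositional.Properties as SublistP
import Data.List.Relation.Unary.Unique.Propositional.Properties as UniqueP
open import Data.Product using (∃; _×_; _,_; proj₁; proj₂)
open import Data.Sum as Sum using (_⊎_; inj₁; inj₂; [_,_]′)
open import Data.Empty using (⊥; ⊥-elim)
open import Relation.Nullary using (¬_; Dec; yes; no; does)
open import Relation.Nullary.Decidable using (⌊_⌋; _×-dec_; _→-dec_; ¬?)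
open import Relation.Unary using (Pred; Decidable)
open import Relation.Binary using (Rel; IsDecEquivalence; Tri; tri<; tri≈; tri>)
open import Relation.Binary.PropositionalEquality as ≡ using (_≡_; _≗_; refl; cong; cong₂; sym; trans; subst)
open import Relation.Binary.Construct.Closure.ReflexiveTransitive as Star using (ε; _◅_; _◅◅_)
open import Function using (_∘_)
open import Function.Construct.Identity using (↔-id)
open import Algebra.Bundles using (CommutativeRing)
open import Defs

private variable
  a p q r : Level
  A B : Set a

count : {P : Pred A p} → Decidable P → List A → ℕ
count P? xs = length (filter P? xs)

module _ {P : Pred A p} {Q : Pred A q} (P? : Decidable P) (Q? : Decidable Q) where

  count-cong : ∀ xs → (∀ {x} → x ∈ xs → (P x → Q x) × (Q x → P x)) → count P? xs ≡ count Q? xs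
  count-cong [] h = refl
  count-cong (x ∷ xs) h with P? x | Q? x
  ... | yes px | yes qx = cong suc (count-cong xs (h ∘ there))
  ... | yes px | no ¬qx = ⊥-elim (¬qx (proj₁ (h (here refl)) px))
  ... | no ¬px | yes qx = ⊥-elim (¬px (proj₂ (h (here refl)) qx))
  ... | no ¬px | no ¬qx = count-cong xs (h ∘ there)

  count-mono : ∀ xs → (∀ {x} → x ∈ xs → P x → Q x) → count P? xs ≤ count Q? xs
  count-mono [] h = z≤n
  count-mono (x ∷ xs) h with P? x | Q? x
  ... | yes px | yes qx = s≤s (count-mono xs (h ∘ there))
  ... | yes px | no ¬qx = ⊥-elim (¬qx (h (here refl) px))
  ... | no ¬px | yes qx = ℕP.m≤n⇒m≤1+n (count-mono xs (h ∘ there))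
  ... | no ¬px | no ¬qx = count-mono xs (h ∘ there)

  count-< : ∀ xs → (∀ {x} → x ∈ xs → P x → Q x) → ∀ {y} → y ∈ xs → Q y → ¬ P y →
            count P? xs < count Q? xs
  count-< (x ∷ xs) h (here refl) qy ¬py with P? x | Q? x
  ... | yes px | _      = ⊥-elim (¬py px)
  ... | no _   | yes _  = s≤s (count-mono xs (h ∘ there))
  ... | no _   | no ¬qx = ⊥-elim (¬qx qy)
  count-< (x ∷ xs) h (there y∈) qy ¬py with P? x | Q? x
  ... | yes px | yes qx = s≤s (count-< xs (h ∘ there) y∈ qy ¬py)
  ... | yes px | no ¬qx = ⊥-elim (¬qx (h (here refl) px))
  ... | no ¬px | yes qx = ℕP.m≤n⇒m≤1+n (count-< xs (h ∘ there) y∈ qy ¬py)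
  ... | no ¬px | no ¬qx = count-< xs (h ∘ there) y∈ qy ¬py

module _ {P : Pred A p} (P? : Decidable P) where

  count-≡0 : ∀ xs → (∀ {x} → x ∈ xs → ¬ P x) → count P? xs ≡ 0
  count-≡0 [] h = refl
  count-≡0 (x ∷ xs) h with P? x
  ... | yes px = ⊥-elim (h (here refl) px)
  ... | no _ = count-≡0 xs (h ∘ there)

  count-pos⇒∃ : ∀ xs → 0 < count P? xs → ∃ λ x → x ∈ xs × P x
  count-pos⇒∃ (x ∷ xs) h with P? x
  ... | yes px = x , here refl , px
  ... | no _ with count-pos⇒∃ xs h
  ...   | y , y∈ , py = y , there y∈ , py

  count-≤1 : ∀ xs → Unique xs → (∀ {y z} → P y → P z → y ≡ z) → count P? xs ≤ 1
  count-≤1 [] u h = z≤n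
  count-≤1 (x ∷ xs) (x∉ ∷ u) h with P? x
  ... | no _ = count-≤1 xs u h
  ... | yes px = s≤s (ℕP.≤-reflexive (count-≡0 xs λ y∈ py → AllP.All¬⇒¬Any x∉ (subst (_∈ xs) (sym (h px py)) y∈)))

  count-≡1 : ∀ xs → Unique xs → (∀ {y z} → P y → P z → y ≡ z) → ∀ {x} → x ∈ xs → P x → count P? xs ≡ 1
  count-≡1 xs u h x∈ px = ℕP.≤-antisym (count-≤1 xs u h) (LP.filter-some P? (Any.map (λ { refl → px }) x∈))

count-⊎ : {P : Pred A p} {Q R : Pred A q} (P? : Decidable P) (Q? : Decidable Q) (R? : Decidable R) → ∀ xs →
  (∀ {x} → x ∈ xs → (P x → Q x ⊎ R x) × (Q x → P x) × (R x → P x) × (Q x → R x → ⊥)) →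
  count P? xs ≡ count Q? xs ℕ.+ count R? xs
count-⊎ P? Q? R? [] h = refl
count-⊎ P? Q? R? (x ∷ xs) h with P? x | Q? x | R? x | h (here refl) | count-⊎ P? Q? R? xs (h ∘ there)
... | yes px | yes qx | yes rx | (_ , _ , _ , disj) | _  = ⊥-elim (disj qx rx)
... | yes px | yes qx | no _   | _                   | ih = cong suc ih
... | yes px | no _   | yes _  | _                   | ih = trans (cong suc ih) (sym (ℕP.+-suc _ _))
... | yes px | no ¬qx | no ¬rx | (cover , _)         | _  = ⊥-elim ([ ¬qx , ¬rx ]′ (cover px))
... | no ¬px | yes qx | _      | (_ , q⇒p , _)       | _  = ⊥-elim (¬px (q⇒p qx))
... | no ¬px | no _   | yes rx | (_ , _ , r⇒p , _)   | _  = ⊥-elim (¬px (r⇒p rx))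
... | no ¬px | no _   | no _   | _                   | ih = ih

count-++ : {P : Pred A p} (P? : Decidable P) → ∀ xs ys → count P? (xs ++ ys) ≡ count P? xs ℕ.+ count P? ys
count-++ P? xs ys = trans (cong length (LP.filter-++ P? xs ys)) (LP.length-++ (filter P? xs))

count-map : {P : Pred B p} (P? : Decidable P) (f : A → B) → ∀ xs → count P? (map f xs) ≡ count (P? ∘ f) xs
count-map P? f [] = refl
count-map P? f (x ∷ xs) with P? (f x)
... | yes _ = cong suc (count-map P? f xs)
... | no _ = count-map P? f xs

count-concatMap : {P : Pred B p} {Q : Pred A q} (P? : Decidable P) (Q? : Decidable Q) (f : A → List B) → ∀ xs →
  (∀ {x} → x ∈ xs → count P? (f x) ≡ count Q? [ x ]) → count P? (concatMap f xs) ≡ count Q? xs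
count-concatMap P? Q? f [] e = refl
count-concatMap P? Q? f (x ∷ xs) e = begin
  count P? (f x ++ concatMap f xs)                 ≡⟨ count-++ P? (f x) (concatMap f xs) ⟩
  count P? (f x) ℕ.+ count P? (concatMap f xs)     ≡⟨ cong₂ ℕ._+_ (e (here refl)) (count-concatMap P? Q? f xs (e ∘ there)) ⟩
  count Q? [ x ] ℕ.+ count Q? xs                   ≡⟨ count-++ Q? [ x ] xs ⟨
  count Q? (x ∷ xs)                                ∎
  where open ≡.≡-Reasoning

discrete-ivt : (f : ℕ → ℕ) → f 0 ≡ 0 → (∀ y → f (suc y) ≤ suc (f y)) →
  ∀ y t → t < f y → ∃ λ x → x < y × f x ≡ t × f (suc x) ≡ suc t
discrete-ivt f f0 step zero t t<f0 = ⊥-elim (ℕP.n≮0 (subst (t <_) f0 t<f0))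
discrete-ivt f f0 step (suc y) t t<f with t ℕ.<? f y
... | yes t<fy = let x , x<y , rest = discrete-ivt f f0 step y t t<fy in x , ℕP.m≤n⇒m≤1+n x<y , rest
... | no t≮fy = y , ℕP.n<1+n y , sym t≡fy , ℕP.≤-antisym (subst (λ s → f (suc y) ≤ suc s) (sym t≡fy) (step y)) t<f
  where
  t≡fy : t ≡ f y
  t≡fy = ℕP.≤-antisym (ℕP.≤-pred (ℕP.<-≤-trans t<f (step y))) (ℕP.≮⇒≥ t≮fy)

Least : ∀ {n} → Pred (Fin n) p → Pred (Fin n) p
Least P r = P r × (∀ j → j F.< r → ¬ P j)

least : ∀ {n} {P : Pred (Fin n) p} → Decidable P → ∀ i → P i → ∃ (Least P)
least {n = suc n} P? i pi with P? zero
... | yes p0 = zero , p0 , λ _ ()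
least {n = suc n} P? zero pi | no ¬p0 = ⊥-elim (¬p0 pi)
least {n = suc n} P? (suc i) pi | no ¬p0 with least (P? ∘ suc) i pi
... | r , pr , below = suc r , pr , λ { zero _ → ¬p0 ; (suc j) (s≤s j<r) → below j j<r }

least-unique : ∀ {n} {P : Pred (Fin n) p} {r r'} → Least P r → Least P r' → r ≡ r'
least-unique {r = r} {r'} (pr , below) (pr' , below') =
  FP.toℕ-injective (ℕP.≤-antisym (ℕP.≮⇒≥ (λ r'<r → below r' r'<r pr')) (ℕP.≮⇒≥ (λ r<r' → below' r r<r' pr)))

module _ {n k k'} {π : Fin n → Fin k} {π' : Fin n → Fin k'}
         (canon : IsCanonical π) (canon' : IsCanonical π')
         (ker⇒ : ∀ i j → π i ≡ π j → π' i ≡ π' j) (ker⇐ : ∀ i j → π' i ≡ π' j → π i ≡ π j) where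

  private
    -- If π and π' agree below i, the class π' i cannot have a smaller index than π i, since
    -- canonicity of π' would produce an earlier vertex in the class π i.
    not-below : ∀ {k k'} {π : Fin n → Fin k} {π' : Fin n → Fin k'} → IsCanonical π' →
      (∀ i j → π i ≡ π j → π' i ≡ π' j) →
      ∀ i → (∀ j → j F.< i → toℕ (π j) ≡ toℕ (π' j)) → ¬ toℕ (π i) < toℕ (π' i)
    not-below {π = π} {π'} canon' ker i agree lt = ℕP.<-irrefl πi≡π'i lt
      where
      c<k' = ℕP.<-trans lt (FP.toℕ<n (π' i))
      toℕ-c : toℕ (fromℕ< c<k') ≡ toℕ (π i)
      toℕ-c = FP.toℕ-fromℕ< c<k'
      earlier : ∃ λ j → j F.< i × π' j ≡ fromℕ< c<k'
      earlier = canon' i (fromℕ< c<k') (subst (_< toℕ (π' i)) (sym toℕ-c) lt)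
      j = proj₁ earlier
      π'j≡c = proj₂ (proj₂ earlier)
      πj≡πi : π j ≡ π i
      πj≡πi = FP.toℕ-injective (trans (agree j (proj₁ (proj₂ earlier))) (trans (cong toℕ π'j≡c) toℕ-c))
      πi≡π'i : toℕ (π i) ≡ toℕ (π' i)
      πi≡π'i = trans (sym toℕ-c) (cong toℕ (trans (sym π'j≡c) (ker j i πj≡πi)))

    agree-below : ∀ t i → toℕ i < t → toℕ (π i) ≡ toℕ (π' i)
    agree-below (suc t) i (s≤s i≤t) = ℕP.≤-antisym
      (ℕP.≮⇒≥ (not-below canon ker⇐ i (λ j j<i → sym (ih j j<i))))
      (ℕP.≮⇒≥ (not-below canon' ker⇒ i ih))
      where
      ih : ∀ j → j F.< i → toℕ (π j) ≡ toℕ (π' j)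
      ih j j<i = agree-below t j (ℕP.<-≤-trans j<i i≤t)

  canonical-unique : ∀ i → toℕ (π i) ≡ toℕ (π' i)
  canonical-unique i = agree-below (suc (toℕ i)) i ℕP.≤-refl

  canonical-unique-size : IsSurj π → IsSurj π' → k ≡ k'
  canonical-unique-size surj surj' = ℕP.≤-antisym (≤-by-surj surj (sym ∘ canonical-unique)) (≤-by-surj surj' canonical-unique)
    where
    ≤-by-surj : ∀ {k k'} {ρ : Fin n → Fin k} {ρ' : Fin n → Fin k'} →
      IsSurj ρ → (∀ i → toℕ (ρ' i) ≡ toℕ (ρ i)) → k ≤ k'
    ≤-by-surj {k' = k'} {ρ} {ρ'} surj same = ℕP.≮⇒≥ λ k'<k →
      let i , ρi≡ = surj (fromℕ< k'<k) in
      ℕP.<-irrefl (trans (same i) (trans (cong toℕ ρi≡) (FP.toℕ-fromℕ< k'<k))) (FP.toℕ<n (ρ' i))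

module Classes {n} {_∼_ : Rel (Fin n) r} (isDecEquivalence : IsDecEquivalence _∼_) where
  open IsDecEquivalence isDecEquivalence
    renaming (refl to ∼-refl; sym to ∼-sym; trans to ∼-trans; _≟_ to _∼?_)

  IsLeast : Pred (Fin n) r
  IsLeast i = ∀ j → j F.< i → ¬ j ∼ i

  isLeast? : Decidable IsLeast
  isLeast? i = FP.all? (λ j → (j FP.<? i) →-dec ¬? (j ∼? i))

  #classes : ℕ
  #classes = count isLeast? (allFin n)

  private
    repr : ∀ i → ∃ (Least (_∼ i))
    repr i = least (_∼? i) i ∼-refl

  rep : Fin n → Fin n
  rep i = proj₁ (repr i)

  rep-∼ : ∀ i → rep i ∼ i
  rep-∼ i = proj₁ (proj₂ (repr i))

  rep-isLeast : ∀ i → IsLeast (rep i)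
  rep-isLeast i j j<r j∼r = proj₂ (proj₂ (repr i)) j j<r (∼-trans j∼r (rep-∼ i))

  rep-≤ : ∀ i → toℕ (rep i) ≤ toℕ i
  rep-≤ i = ℕP.≮⇒≥ (λ i<r → proj₂ (proj₂ (repr i)) i i<r ∼-refl)

  rep-cong : ∀ {i j} → i ∼ j → rep i ≡ rep j
  rep-cong {i} {j} i∼j = least-unique
    (∼-trans (rep-∼ i) i∼j , λ k k<r k∼j → proj₂ (proj₂ (repr i)) k k<r (∼-trans k∼j (∼-sym i∼j)))
    (proj₂ (repr j))

  rep-of-least : ∀ {m} → IsLeast m → rep m ≡ m
  rep-of-least {m} least-m = least-unique (proj₂ (repr m)) (∼-refl , least-m)

  rep-≡⇒∼ : ∀ {i j} → rep i ≡ rep j → i ∼ j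
  rep-≡⇒∼ {i} {j} eq = ∼-trans (∼-sym (rep-∼ i)) (subst (_∼ j) (sym eq) (rep-∼ j))

  -- Classes are numbered by how many least elements precede their own.
  leastBelow? : (y : ℕ) → Decidable (λ m → IsLeast m × toℕ m < y)
  leastBelow? y m = isLeast? m ×-dec (toℕ m ℕ.<? y)

  #below : ℕ → ℕ
  #below y = count (leastBelow? y) (allFin n)

  private
    leastAt? : ∀ y → Decidable (λ m → IsLeast m × toℕ m ≡ y)
    leastAt? y m = isLeast? m ×-dec (toℕ m ℕ.≟ y)

    #below-suc : ∀ y → #below (suc y) ≡ #below y ℕ.+ count (leastAt? y) (allFin n)
    #below-suc y = count-⊎ (leastBelow? (suc y)) (leastBelow? y) (leastAt? y) (allFin n) λ _ →
        (λ (m , m<1+y) → Sum.map (m ,_) (m ,_) (ℕP.m≤n⇒m<n∨m≡n (ℕP.≤-pred m<1+y)))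
      , (λ (m , m<y) → m , ℕP.m≤n⇒m≤1+n m<y)
      , (λ (m , m≡y) → m , ℕP.≤-reflexive (cong suc m≡y))
      , λ (_ , m<y) (_ , m≡y) → ℕP.<-irrefl m≡y m<y

    #leastAt≤1 : ∀ y → count (leastAt? y) (allFin n) ≤ 1
    #leastAt≤1 y = count-≤1 (leastAt? y) (allFin n) (UniqueP.allFin⁺ n)
      (λ (_ , a) (_ , b) → FP.toℕ-injective (trans a (sym b)))

  #below-n : #below n ≡ #classes
  #below-n = count-cong (leastBelow? n) isLeast? (allFin n) (λ {m} _ → proj₁ , (_, FP.toℕ<n m))

  #below-< : ∀ {m} y → IsLeast m → toℕ m < y → #below (toℕ m) < #below y
  #below-< {m} y least-m m<y = count-< (leastBelow? (toℕ m)) (leastBelow? y) (allFin n)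
    (λ _ (l , l<m) → l , ℕP.<-trans l<m m<y) (∈-allFin m) (least-m , m<y) (λ (_ , m<m) → ℕP.<-irrefl refl m<m)

  #below-0 : #below 0 ≡ 0
  #below-0 = count-≡0 (leastBelow? 0) (allFin n) (λ _ ())

  #below-suc-≤ : ∀ y → #below (suc y) ≤ suc (#below y)
  #below-suc-≤ y = begin
    #below (suc y)                                  ≡⟨ #below-suc y ⟩
    #below y ℕ.+ count (leastAt? y) (allFin n)      ≤⟨ ℕP.+-monoʳ-≤ (#below y) (#leastAt≤1 y) ⟩
    #below y ℕ.+ 1                                  ≡⟨ ℕP.+-comm (#below y) 1 ⟩
    suc (#below y)                                  ∎
    where open ℕP.≤-Reasoning

  #below-step⇒least : ∀ y → #below (suc y) ≡ suc (#below y) → ∃ λ m → IsLeast m × toℕ m ≡ y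
  #below-step⇒least y step = let m , _ , least-at-m = count-pos⇒∃ (leastAt? y) (allFin n) one-at-y in m , least-at-m
    where
    one-at-y : 0 < count (leastAt? y) (allFin n)
    one-at-y = subst (0 <_) (sym (ℕP.+-cancelˡ-≡ (#below y) _ 1
      (trans (sym (#below-suc y)) (trans step (ℕP.+-comm 1 (#below y)))))) (s≤s z≤n)

  least-with-#below : ∀ y t → t < #below y → ∃ λ m → IsLeast m × toℕ m < y × #below (toℕ m) ≡ t
  least-with-#below y t t<
    with x , x<y , #x≡t , #1+x≡1+t ← discrete-ivt #below #below-0 #below-suc-≤ y t t<
    with m , least-m , m≡x ← #below-step⇒least x (trans #1+x≡1+t (cong suc (sym #x≡t)))
    = m , least-m , subst (_< y) (sym m≡x) x<y , trans (cong #below m≡x) #x≡t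

  private
    classIndex< : ∀ i → #below (toℕ (rep i)) < #classes
    classIndex< i = subst (#below (toℕ (rep i)) <_) #below-n (#below-< n (rep-isLeast i) (FP.toℕ<n (rep i)))

  classIndex : Fin n → Fin #classes
  classIndex i = fromℕ< (classIndex< i)

  toℕ-classIndex : ∀ i → toℕ (classIndex i) ≡ #below (toℕ (rep i))
  toℕ-classIndex i = FP.toℕ-fromℕ< (classIndex< i)

  toℕ-classIndex-least : ∀ {m} → IsLeast m → toℕ (classIndex m) ≡ #below (toℕ m)
  toℕ-classIndex-least {m} least-m = trans (toℕ-classIndex m) (cong (#below ∘ toℕ) (rep-of-least least-m))

  classIndex-surjective : IsSurj classIndex
  classIndex-surjective c = m , FP.toℕ-injective (trans (toℕ-classIndex-least least-m) #m≡c)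
    where
    c<#below-n : toℕ c < #below n
    c<#below-n = subst (toℕ c <_) (sym #below-n) (FP.toℕ<n c)
    found : ∃ λ m → IsLeast m × toℕ m < n × #below (toℕ m) ≡ toℕ c
    found = least-with-#below n (toℕ c) c<#below-n
    m = proj₁ found
    least-m = proj₁ (proj₂ found)
    #m≡c = proj₂ (proj₂ (proj₂ found))

  classIndex-canonical : IsCanonical classIndex
  classIndex-canonical i c c<i =
    m , ℕP.<-≤-trans m<r (rep-≤ i) , FP.toℕ-injective (trans (toℕ-classIndex-least least-m) #m≡c)
    where
    found : ∃ λ m → IsLeast m × toℕ m < toℕ (rep i) × #below (toℕ m) ≡ toℕ c
    found = least-with-#below (toℕ (rep i)) (toℕ c) (subst (toℕ c <_) (toℕ-classIndex i) c<i)
    m = proj₁ found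
    least-m = proj₁ (proj₂ found)
    m<r = proj₁ (proj₂ (proj₂ found))
    #m≡c = proj₂ (proj₂ (proj₂ found))

  ∼⇒classIndex-≡ : ∀ {i j} → i ∼ j → classIndex i ≡ classIndex j
  ∼⇒classIndex-≡ i∼j = FP.toℕ-injective
    (trans (toℕ-classIndex _) (trans (cong (#below ∘ toℕ) (rep-cong i∼j)) (sym (toℕ-classIndex _))))

  classIndex-≡⇒∼ : ∀ {i j} → classIndex i ≡ classIndex j → i ∼ j
  classIndex-≡⇒∼ {i} {j} eq =
    rep-≡⇒∼ (FP.toℕ-injective (ℕP.≤-antisym (ℕP.≮⇒≥ (no-< j i (sym eq))) (ℕP.≮⇒≥ (no-< i j eq))))
    where
    no-< : ∀ i j → classIndex i ≡ classIndex j → ¬ toℕ (rep i) < toℕ (rep j)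
    no-< i j eq r<r' = ℕP.<-irrefl
      (trans (sym (toℕ-classIndex i)) (trans (cong toℕ eq) (toℕ-classIndex j)))
      (#below-< (toℕ (rep j)) (rep-isLeast i) r<r')

  IsClassMap : ∀ {k} → (Fin n → Fin k) → Set r
  IsClassMap π = IsSurj π × IsCanonical π × (∀ i j → (π i ≡ π j → i ∼ j) × (i ∼ j → π i ≡ π j))

  private
    kernel-vs-classIndex : ∀ {k} {π : Fin n → Fin k} → (∀ i j → (π i ≡ π j → i ∼ j) × (i ∼ j → π i ≡ π j)) →
      (∀ i j → π i ≡ π j → classIndex i ≡ classIndex j) × (∀ i j → classIndex i ≡ classIndex j → π i ≡ π j)
    kernel-vs-classIndex ker =
      (λ i j → ∼⇒classIndex-≡ ∘ proj₁ (ker i j)) , (λ i j → proj₂ (ker i j) ∘ classIndex-≡⇒∼)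

  classMap-size : ∀ {k} {π : Fin n → Fin k} → IsClassMap π → k ≡ #classes
  classMap-size (surj , canon , ker) = let ker⇒ , ker⇐ = kernel-vs-classIndex ker in
    canonical-unique-size canon classIndex-canonical ker⇒ ker⇐ surj classIndex-surjective

  classMap≗classIndex : ∀ {π : Fin n → Fin #classes} → IsClassMap π → ∀ i → π i ≡ classIndex i
  classMap≗classIndex (_ , canon , ker) i = let ker⇒ , ker⇐ = kernel-vs-classIndex ker in
    FP.toℕ-injective (canonical-unique canon classIndex-canonical ker⇒ ker⇐ i)

  ≗classIndex⇒classMap : ∀ {π : Fin n → Fin #classes} → (∀ i → π i ≡ classIndex i) → IsClassMap π
  ≗classIndex⇒classMap {π} π≗ =
      (λ c → let i , eq = classIndex-surjective c in i , trans (π≗ i) eq)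
    , (λ i c c<πi → let j , j<i , eq = classIndex-canonical i c (subst (c F.<_) (π≗ i) c<πi) in j , j<i , trans (π≗ j) eq)
    , λ i j → (λ eq → classIndex-≡⇒∼ (trans (sym (π≗ i)) (trans eq (π≗ j))))
            , (λ i∼j → trans (π≗ i) (trans (∼⇒classIndex-≡ i∼j) (sym (π≗ j))))

#classes≤n : ∀ {n} {_∼_ : Rel (Fin n) r} (d : IsDecEquivalence _∼_) → Classes.#classes d ≤ n
#classes≤n {n = n} d =
  ℕP.≤-trans (LP.length-filter (Classes.isLeast? d) (allFin n)) (ℕP.≤-reflexive (LP.length-tabulate (λ i → i)))

module _ {n} {_∼₁_ _∼₂_ : Rel (Fin n) r} (d₁ : IsDecEquivalence _∼₁_) (d₂ : IsDecEquivalence _∼₂_) where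
  private
    module C₁ = Classes d₁
    module C₂ = Classes d₂
    module E₁ = IsDecEquivalence d₁
    module E₂ = IsDecEquivalence d₂

  #classes-cong : (∀ i j → (i ∼₁ j → i ∼₂ j) × (i ∼₂ j → i ∼₁ j)) → C₁.#classes ≡ C₂.#classes
  #classes-cong same = count-cong C₁.isLeast? C₂.isLeast? (allFin n) λ _ →
    (λ least k k<i k∼i → least k k<i (proj₂ (same k _) k∼i)) , (λ least k k<i k∼i → least k k<i (proj₁ (same k _) k∼i))

  coarsening-with-#classes-≡ : (∀ {i j} → i ∼₁ j → i ∼₂ j) → C₁.#classes ≡ C₂.#classes →
    ∀ {i j} → i ∼₂ j → i ∼₁ j
  coarsening-with-#classes-≡ ∼₁⇒∼₂ same-# {i} {j} i∼₂j with i E₁.≟ j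
  ... | yes i∼₁j = i∼₁j
  ... | no i≁₁j = ⊥-elim (distinct-reps (FP.<-cmp (C₁.rep i) (C₁.rep j)))
    where
    r∼₂r' : C₁.rep i ∼₂ C₁.rep j
    r∼₂r' = E₂.trans (∼₁⇒∼₂ (C₁.rep-∼ i)) (E₂.trans i∼₂j (∼₁⇒∼₂ (E₁.sym (C₁.rep-∼ j))))
    -- every ∼₂-least element is ∼₁-least, but b is ∼₁-least and not ∼₂-least
    fewer : ∀ {a b} → a F.< b → C₁.IsLeast b → a ∼₂ b → ⊥
    fewer {a} {b} a<b least-b a∼₂b = ℕP.<-irrefl (sym same-#)
      (count-< C₂.isLeast? C₁.isLeast? (allFin n) mono (∈-allFin b) least-b (λ least₂ → least₂ a a<b a∼₂b))
      where
      mono : ∀ {l} → l ∈ allFin n → C₂.IsLeast l → C₁.IsLeast l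
      mono _ least k k<l k∼l = least k k<l (∼₁⇒∼₂ k∼l)
    distinct-reps : Tri (C₁.rep i F.< C₁.rep j) (C₁.rep i ≡ C₁.rep j) (C₁.rep j F.< C₁.rep i) → ⊥
    distinct-reps (tri< a<b _ _) = fewer a<b (C₁.rep-isLeast j) r∼₂r'
    distinct-reps (tri≈ _ a≡b _) = i≁₁j (C₁.rep-≡⇒∼ a≡b)
    distinct-reps (tri> _ _ b<a) = fewer b<a (C₁.rep-isLeast i) (E₂.sym r∼₂r')

private
  ∧≡true : ∀ {x y} → x ∧ y ≡ true → x ≡ true × y ≡ true
  ∧≡true {true} {true} _ = refl , refl

  ∨≡trueˡ : ∀ {x} y → x ≡ true → x ∨ y ≡ true
  ∨≡trueˡ y refl = refl

  ⌊⌋≡true : {P : Set p} (d : Dec P) → P → ⌊ d ⌋ ≡ true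
  ⌊⌋≡true (yes _) _ = refl
  ⌊⌋≡true (no ¬p) p = ⊥-elim (¬p p)

  ⌊⌋≡true⁻ : {P : Set p} (d : Dec P) → ⌊ d ⌋ ≡ true → P
  ⌊⌋≡true⁻ (yes p) _ = p

  ≤ᵇ≡true⇒≤ : ∀ {m n} → (m ≤ᵇ n) ≡ true → m ≤ n
  ≤ᵇ≡true⇒≤ {m} {n} eq = ℕP.≤ᵇ⇒≤ m n (subst T (sym eq) _)

  ≤⇒≤ᵇ≡true : ∀ {m n} → m ≤ n → (m ≤ᵇ n) ≡ true
  ≤⇒≤ᵇ≡true {m} {n} m≤n with m ≤ᵇ n | ℕP.≤⇒≤ᵇ m≤n
  ... | true | _ = refl

∈ˢ⇒0<∣∣ : ∀ {n} {a : Fin n} {e : Subset n} → a ∈ˢ e → 0 < ∣ e ∣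
∈ˢ⇒0<∣∣ here = s≤s z≤n
∈ˢ⇒0<∣∣ {e = inside ∷ e} (there _) = s≤s z≤n
∈ˢ⇒0<∣∣ {e = outside ∷ e} (there a∈) = ∈ˢ⇒0<∣∣ a∈

∣∣≤1⇒∈ˢ-unique : ∀ {n} {a b : Fin n} {e : Subset n} → ∣ e ∣ ≤ 1 → a ∈ˢ e → b ∈ˢ e → a ≡ b
∣∣≤1⇒∈ˢ-unique _ here here = refl
∣∣≤1⇒∈ˢ-unique (s≤s ∣e∣≤0) here (there b∈) = ⊥-elim (ℕP.<⇒≱ (∈ˢ⇒0<∣∣ b∈) ∣e∣≤0)
∣∣≤1⇒∈ˢ-unique (s≤s ∣e∣≤0) (there a∈) here = ⊥-elim (ℕP.<⇒≱ (∈ˢ⇒0<∣∣ a∈) ∣e∣≤0)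
∣∣≤1⇒∈ˢ-unique {e = inside ∷ e} (s≤s ∣e∣≤0) (there a∈) (there _) =
  ⊥-elim (ℕP.<⇒≱ (∈ˢ⇒0<∣∣ a∈) ∣e∣≤0)
∣∣≤1⇒∈ˢ-unique {e = outside ∷ e} ∣e∣≤1 (there a∈) (there b∈) =
  cong suc (∣∣≤1⇒∈ˢ-unique ∣e∣≤1 a∈ b∈)

edge⇒raw⊎small : ∀ G e → edge G e ≡ true → rawEdge G e ≡ true ⊎ ∣ e ∣ ≤ 1
edge⇒raw⊎small G e h with rawEdge G e | ∣ e ∣ ≤ᵇ 1 in small
... | true  | _    = inj₁ refl
... | false | true = inj₂ (≤ᵇ≡true⇒≤ small)

small⇒edge : ∀ G e → ∣ e ∣ ≤ 1 → edge G e ≡ true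
small⇒edge G e small rewrite ≤⇒≤ᵇ≡true small = BP.∨-zeroʳ _

edge⁺⇒edge : ∀ G e → edge⁺ G e ≡ true → edge G e ≡ true
edge⁺⇒edge G e h = proj₁ (∧≡true h)

edge⁺⇒¬small : ∀ G e → edge⁺ G e ≡ true → ¬ ∣ e ∣ ≤ 1
edge⁺⇒¬small G e h small = ℕP.<⇒≱ (≤ᵇ≡true⇒≤ (proj₂ (∧≡true {edge G e} h))) small

edge⇒edge⁺ : ∀ G e → edge G e ≡ true → ¬ ∣ e ∣ ≤ 1 → edge⁺ G e ≡ true
edge⇒edge⁺ G e h ¬small rewrite h = ≤⇒≤ᵇ≡true (ℕP.≰⇒> ¬small)

connected-isDecEquivalence : ∀ G → IsDecEquivalence (Connected G)
connected-isDecEquivalence G = record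
  { isEquivalence = record
    { refl = ε
    ; sym = Star.reverse (λ (e , h , i∈ , j∈) → e , h , j∈ , i∈)
    ; trans = _◅◅_
    }
  ; _≟_ = connected? G
  }

edge⇒connected : ∀ G {e a b} → edge G e ≡ true → a ∈ˢ e → b ∈ˢ e → Connected G a b
edge⇒connected G {e} h a∈ b∈ = (e , h , a∈ , b∈) ◅ ε

connected-mono : ∀ {n} {r₁ r₂ : Subset n → Bool} → (∀ e → edge (hg n r₁) e ≡ true → edge (hg n r₂) e ≡ true) →
  ∀ {i j} → Connected (hg n r₁) i j → Connected (hg n r₂) i j
connected-mono sub = Star.map (λ (e , h , i∈ , j∈) → e , sub e h , i∈ , j∈)

connected-mono⁺ : ∀ {n} {r₁ r₂ : Subset n → Bool} →
  (∀ e → edge (hg n r₁) e ≡ true → ¬ ∣ e ∣ ≤ 1 → edge (hg n r₂) e ≡ true) →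
  ∀ {i j} → Connected (hg n r₁) i j → Connected (hg n r₂) i j
connected-mono⁺ {n} {r₁} {r₂} sub = connected-mono (λ e h → edge-or-small e h (∣ e ∣ ℕP.≤? 1))
  where
  edge-or-small : ∀ e → edge (hg n r₁) e ≡ true → Dec (∣ e ∣ ≤ 1) → edge (hg n r₂) e ≡ true
  edge-or-small e h (yes small) = small⇒edge (hg n r₂) e small
  edge-or-small e h (no ¬small) = sub e h ¬small

module Restriction (G : Hypergraph) {k} (π : Fin (size G) → Fin k) where

  restr-edge⇒ : ∀ e → edge (restr G π) e ≡ true → (edge G e ≡ true × InOneClass π e) ⊎ ∣ e ∣ ≤ 1
  restr-edge⇒ e h with edge⇒raw⊎small (restr G π) e h
  ... | inj₁ raw = let h , in-class = ∧≡true raw in inj₁ (h , ⌊⌋≡true⁻ (inOneClass? π e) in-class)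
  ... | inj₂ small = inj₂ small

  restr-edge⇐ : ∀ e → edge G e ≡ true → InOneClass π e → edge (restr G π) e ≡ true
  restr-edge⇐ e h in-class = ∨≡trueˡ (∣ e ∣ ≤ᵇ 1) (cong₂ _∧_ h (⌊⌋≡true (inOneClass? π e) in-class))

  restr-connected⇒connected : ∀ {i j} → Connected (restr G π) i j → Connected G i j
  restr-connected⇒connected = connected-mono λ e h → [ proj₁ , small⇒edge G e ]′ (restr-edge⇒ e h)

  restr-connected⇒same-class : ∀ {i j} → Connected (restr G π) i j → π i ≡ π j
  restr-connected⇒same-class ε = refl
  restr-connected⇒same-class ((e , h , i∈ , j∈) ◅ path) with restr-edge⇒ e h
  ... | inj₁ (_ , in-class) = trans (in-class _ _ i∈ j∈) (restr-connected⇒same-class path)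
  ... | inj₂ small rewrite ∣∣≤1⇒∈ˢ-unique small i∈ j∈ = restr-connected⇒same-class path

  connected⇒restr-connected : ∀ {r} →
    (∀ e → edge (hg (size G) r) e ≡ true → ¬ ∣ e ∣ ≤ 1 → edge G e ≡ true × InOneClass π e) →
    ∀ {i j} → Connected (hg (size G) r) i j → Connected (restr G π) i j
  connected⇒restr-connected sub = connected-mono⁺ λ e h ¬small →
    let h , in-class = sub e h ¬small in restr-edge⇐ e h in-class

  same-class⇒inOneClass : ∀ {r} → (∀ {i j} → Connected (hg (size G) r) i j → π i ≡ π j) →
    ∀ e → edge (hg (size G) r) e ≡ true → InOneClass π e
  same-class⇒inOneClass {r} same e h i j i∈ j∈ = same (edge⇒connected (hg (size G) r) h i∈ j∈)

spanning-edge⇒ : ∀ G F e → edge (spanning G F) e ≡ true → e ∈ F ⊎ ∣ e ∣ ≤ 1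
spanning-edge⇒ G F e h = Sum.map₁ (⌊⌋≡true⁻ (Any.any? (e ≟ˢ_) F)) (edge⇒raw⊎small (spanning G F) e h)

spanning-edge⇐ : ∀ G F {e} → e ∈ F → edge (spanning G F) e ≡ true
spanning-edge⇐ G F {e} e∈ = ∨≡trueˡ (∣ e ∣ ≤ᵇ 1) (⌊⌋≡true (Any.any? (e ≟ˢ_) F) e∈)

_≗?_ : ∀ {n k} (f g : Fin n → Fin k) → Dec (f ≗ g)
f ≗? g = FP.all? (λ i → f i F.≟ g i)

allFuns-complete : ∀ n k (g : Fin n → Fin k) → count (_≗? g) (allFuns n k) ≡ 1
allFuns-complete zero k g with (λ ()) ≗? g
... | yes _ = refl
... | no ≉ = ⊥-elim (≉ (λ ()))
allFuns-complete (suc n) k g = begin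
  count (_≗? g) (allFuns (suc n) k)
    ≡⟨ count-concatMap (_≗? g) (F._≟ g zero) _ (allFin k) (λ {c} _ → extend c _ (λ _ → refl) (λ _ _ → refl)) ⟩
  count (F._≟ g zero) (allFin k)
    ≡⟨ count-≡1 (F._≟ g zero) (allFin k) (UniqueP.allFin⁺ k) (λ a b → trans a (sym b)) (∈-allFin (g zero)) refl ⟩
  1 ∎
  where
  open ≡.≡-Reasoning
  extend : ∀ c (cons : (Fin n → Fin k) → (Fin (suc n) → Fin k)) →
    (∀ f → cons f zero ≡ c) → (∀ f i → cons f (suc i) ≡ f i) →
    count (_≗? g) (map cons (allFuns n k)) ≡ count (F._≟ g zero) [ c ]
  extend c cons cons-zero cons-suc with c F.≟ g zero
  ... | yes refl = trans (count-map (_≗? g) cons (allFuns n k))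
    (trans (count-cong _ (_≗? (g ∘ suc)) (allFuns n k)
             (λ {f} _ → (λ eq i → trans (sym (cons-suc f i)) (eq (suc i)))
                      , (λ { eq zero → cons-zero f ; eq (suc i) → trans (cons-suc f i) (eq i) })))
           (allFuns-complete n k (g ∘ suc)))
  ... | no c≢g0 = trans (count-map (_≗? g) cons (allFuns n k))
    (count-≡0 _ (allFuns n k) (λ {f} _ eq → c≢g0 (trans (sym (cons-zero f)) (eq zero))))

allSubsets-complete : ∀ {n} (S : Subset n) → S ∈ allSubsets n
allSubsets-complete [] = here refl
allSubsets-complete (inside ∷ S) = ∈-concatMap⁺ _ (Any.map (λ eq → here (cong (inside ∷_) eq)) (allSubsets-complete S))
allSubsets-complete (outside ∷ S) = ∈-concatMap⁺ _ (Any.map (λ eq → there (here (cong (outside ∷_) eq))) (allSubsets-complete S))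

allSubsets-unique : ∀ n → Unique (allSubsets n)
allSubsets-unique zero = [] ∷ []
allSubsets-unique (suc n) = extend (allSubsets-unique n)
  where
  both : Subset n → List (Subset (suc n))
  both S = (inside ∷ S) ∷ (outside ∷ S) ∷ []
  ∈-both⇒tail : ∀ {T Ss} → T ∈ concatMap both Ss → Vec.tail T ∈ Ss
  ∈-both⇒tail T∈ = Any.map (λ { (here refl) → refl ; (there (here refl)) → refl }) (∈-concatMap⁻ both T∈)
  extend : ∀ {Ss} → Unique Ss → Unique (concatMap both Ss)
  extend [] = []
  extend (S∉ ∷ u) =
      ((λ ()) ∷ All.tabulate (λ { T∈ refl → AllP.All¬⇒¬Any S∉ (∈-both⇒tail T∈) }))
    ∷ All.tabulate (λ { T∈ refl → AllP.All¬⇒¬Any S∉ (∈-both⇒tail T∈) })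
    ∷ extend u

allSubsets-count-≡ : ∀ {n} (S : Subset n) → count (_≟ˢ S) (allSubsets n) ≡ 1
allSubsets-count-≡ {n} S =
  count-≡1 (_≟ˢ S) (allSubsets n) (allSubsets-unique n) (λ a b → trans a (sym b)) (allSubsets-complete S) refl

count-∈ : ∀ {n} (F : List (Subset n)) → Unique F → count (λ S → Any.any? (S ≟ˢ_) F) (allSubsets n) ≡ length F
count-∈ {n} [] _ = count-≡0 (λ S → Any.any? (S ≟ˢ_) []) (allSubsets n) (λ _ ())
count-∈ {n} (f ∷ F) (f∉ ∷ u) = trans
  (count-⊎ (λ S → Any.any? (S ≟ˢ_) (f ∷ F)) (_≟ˢ f) (λ S → Any.any? (S ≟ˢ_) F) (allSubsets n)
    (λ _ → (λ { (here eq) → inj₁ eq ; (there S∈) → inj₂ S∈ }) , here , there ,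
           λ { refl S∈ → AllP.All¬⇒¬Any f∉ S∈ }))
  (cong₂ ℕ._+_ (allSubsets-count-≡ f) (count-∈ F u))

∈edgeList⁺ : ∀ G e → edge⁺ G e ≡ true → e ∈ edgeList⁺ G
∈edgeList⁺ G e h = ∈-filter⁺ (λ S → edge⁺ G S B.≟ true) (allSubsets-complete e) h

edgeList⁺⇒edge⁺ : ∀ G {e} → e ∈ edgeList⁺ G → edge⁺ G e ≡ true
edgeList⁺⇒edge⁺ G e∈ = proj₂ (∈-filter⁻ (λ S → edge⁺ G S B.≟ true) {xs = allSubsets (size G)} e∈)

edgeList⁺-unique : ∀ G → Unique (edgeList⁺ G)
edgeList⁺-unique G = UniqueP.filter⁺ _ (allSubsets-unique (size G))

nEdges⁺-spanning : ∀ G (F : List (Subset (size G))) → Unique F → All (λ e → edge⁺ G e ≡ true) F →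
  nEdges⁺ (spanning G F) ≡ length F
nEdges⁺-spanning G F u F⊆E⁺ = trans
  (count-cong (λ S → edge⁺ (spanning G F) S B.≟ true) (λ S → Any.any? (S ≟ˢ_) F) (allSubsets (size G))
    (λ {S} _ → (λ h → [ (λ S∈ → S∈) , (λ small → ⊥-elim (edge⁺⇒¬small (spanning G F) S h small)) ]′
                         (spanning-edge⇒ G F S (edge⁺⇒edge (spanning G F) S h)))
             , (λ S∈ → edge⇒edge⁺ (spanning G F) S (spanning-edge⇐ G F S∈)
                         (edge⁺⇒¬small G S (All.lookup F⊆E⁺ S∈)))))
  (count-∈ F u)

sublists⇒⊆ : ∀ (L : List A) {F} → F ∈ sublists L → F ⊆ L
sublists⇒⊆ [] (here refl) = []
sublists⇒⊆ (x ∷ xs) F∈ with ∈-++⁻ (map (x ∷_) (sublists xs)) F∈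
... | inj₁ F∈x∷ with ∈-map⁻ (x ∷_) F∈x∷
...   | F' , F'∈ , refl = refl ∷ sublists⇒⊆ xs F'∈
sublists⇒⊆ (x ∷ xs) F∈ | inj₂ F∈xs = x ∷ʳ sublists⇒⊆ xs F∈xs

Unique-resp-⊇ : ∀ {F L : List A} → F ⊆ L → Unique L → Unique F
Unique-resp-⊇ [] u = u
Unique-resp-⊇ (_ ∷ʳ F⊆L) (_ ∷ u) = Unique-resp-⊇ F⊆L u
Unique-resp-⊇ (refl ∷ F⊆L) (x∉ ∷ u) = SublistP.All-resp-⊆ F⊆L x∉ ∷ Unique-resp-⊇ F⊆L u

filter-filter : {P : Pred A p} {Q : Pred A q} (P? : Decidable P) (Q? : Decidable Q) →
  ∀ xs → filter P? (filter Q? xs) ≡ filter (λ x → Q? x ×-dec P? x) xs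
filter-filter P? Q? [] = refl
filter-filter P? Q? (x ∷ xs) with Q? x
... | no _ = filter-filter P? Q? xs
... | yes _ with P? x
...   | yes _ = cong (x ∷_) (filter-filter P? Q? xs)
...   | no _  = filter-filter P? Q? xs

module _ {P : Pred A p} (P? : Decidable P) where

  private
    filter-all-cons : ∀ {x} → P x → ∀ Fs → filter (All.all? P?) (map (x ∷_) Fs) ≡ map (x ∷_) (filter (All.all? P?) Fs)
    filter-all-cons px [] = refl
    filter-all-cons {x} px (F ∷ Fs) = by-cases (All.all? P? F)
      where
      open ≡.≡-Reasoning
      by-cases : Dec (All P F) → filter (All.all? P?) (map (x ∷_) (F ∷ Fs)) ≡ map (x ∷_) (filter (All.all? P?) (F ∷ Fs))
      by-cases (yes all-F) = begin
        filter (All.all? P?) ((x ∷ F) ∷ map (x ∷_) Fs)    ≡⟨ LP.filter-accept (All.all? P?) (px ∷ all-F) ⟩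
        (x ∷ F) ∷ filter (All.all? P?) (map (x ∷_) Fs)    ≡⟨ cong ((x ∷ F) ∷_) (filter-all-cons px Fs) ⟩
        map (x ∷_) (F ∷ filter (All.all? P?) Fs)          ≡⟨ cong (map (x ∷_)) (LP.filter-accept (All.all? P?) all-F) ⟨
        map (x ∷_) (filter (All.all? P?) (F ∷ Fs))        ∎
      by-cases (no ¬all-F) = begin
        filter (All.all? P?) ((x ∷ F) ∷ map (x ∷_) Fs)    ≡⟨ LP.filter-reject (All.all? P?) (¬all-F ∘ All.tail) ⟩
        filter (All.all? P?) (map (x ∷_) Fs)              ≡⟨ filter-all-cons px Fs ⟩
        map (x ∷_) (filter (All.all? P?) Fs)              ≡⟨ cong (map (x ∷_)) (LP.filter-reject (All.all? P?) ¬all-F) ⟨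
        map (x ∷_) (filter (All.all? P?) (F ∷ Fs))        ∎

    filter-all-cons-none : ∀ {x} → ¬ P x → ∀ Fs → filter (All.all? P?) (map (x ∷_) Fs) ≡ []
    filter-all-cons-none ¬px Fs = LP.filter-none (All.all? P?) (AllP.map⁺ (All.universal (λ { _ (px ∷ _) → ¬px px }) Fs))

  sublists-filter : ∀ xs → sublists (filter P? xs) ≡ filter (All.all? P?) (sublists xs)
  sublists-filter [] = refl
  sublists-filter (x ∷ xs) with P? x
  ... | yes px = begin
    map (x ∷_) (sublists (filter P? xs)) ++ sublists (filter P? xs)
      ≡⟨ cong (λ S → map (x ∷_) S ++ S) (sublists-filter xs) ⟩
    map (x ∷_) (filter (All.all? P?) (sublists xs)) ++ filter (All.all? P?) (sublists xs)
      ≡⟨ cong (_++ filter (All.all? P?) (sublists xs)) (filter-all-cons px (sublists xs)) ⟨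
    filter (All.all? P?) (map (x ∷_) (sublists xs)) ++ filter (All.all? P?) (sublists xs)
      ≡⟨ LP.filter-++ (All.all? P?) (map (x ∷_) (sublists xs)) (sublists xs) ⟨
    filter (All.all? P?) (map (x ∷_) (sublists xs) ++ sublists xs)
      ∎
    where open ≡.≡-Reasoning
  ... | no ¬px = begin
    sublists (filter P? xs)
      ≡⟨ sublists-filter xs ⟩
    filter (All.all? P?) (sublists xs)
      ≡⟨ cong (_++ filter (All.all? P?) (sublists xs)) (filter-all-cons-none ¬px (sublists xs)) ⟨
    filter (All.all? P?) (map (x ∷_) (sublists xs)) ++ filter (All.all? P?) (sublists xs)
      ≡⟨ LP.filter-++ (All.all? P?) (map (x ∷_) (sublists xs)) (sublists xs) ⟨
    filter (All.all? P?) (map (x ∷_) (sublists xs) ++ sublists xs)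
      ∎
    where open ≡.≡-Reasoning

module Components (G : Hypergraph) = Classes (connected-isDecEquivalence G)

EdgesWithinClasses : (G : Hypergraph) {k : ℕ} → (Fin (size G) → Fin k) → Set
EdgesWithinClasses G π = All (InOneClass π) (edgeList⁺ G)

withinClasses? : ∀ G {k} (π : Fin (size G) → Fin k) → Dec (EdgesWithinClasses G π)
withinClasses? G π = All.all? (inOneClass? π) (edgeList⁺ G)

private
  bool-ext : ∀ {b c} → (b ≡ true → c ≡ true) → (c ≡ true → b ≡ true) → b ≡ c
  bool-ext {false} {false} _ _ = refl
  bool-ext {false} {true} _ c⇒b = c⇒b refl
  bool-ext {true} {false} b⇒c _ = sym (b⇒c refl)
  bool-ext {true} {true} _ _ = refl

image-id : ∀ {n} (S : Subset n) → image (λ x → x) S ≡ S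
image-id S = trans (VP.tabulate-cong pointwise) (VP.tabulate∘lookup S)
  where
  pointwise : ∀ c → ⌊ FP.any? (λ j → (j ∈? S) ×-dec (j F.≟ c)) ⌋ ≡ Vec.lookup S c
  pointwise c with FP.any? (λ j → (j ∈? S) ×-dec (j F.≟ c))
  ... | yes (j , j∈ , refl) = sym (VP.[]=⇒lookup j∈)
  ... | no ∄ with Vec.lookup S c in eq
  ...   | false = refl
  ...   | true  = ⊥-elim (∄ (c , VP.lookup⇒[]= c S eq , refl))

module _ (G : Hypergraph) {k} (π : Fin (size G) → Fin k) where
  open Restriction G π

  edgeList⁺-restr : edgeList⁺ (restr G π) ≡ filter (inOneClass? π) (edgeList⁺ G)
  edgeList⁺-restr = sym (trans (filter-filter (inOneClass? π) (λ S → edge⁺ G S B.≟ true) (allSubsets (size G)))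
    (LP.filter-≐ _ (λ S → edge⁺ (restr G π) S B.≟ true) (to , from) (allSubsets (size G))))
    where
    to : ∀ {e} → edge⁺ G e ≡ true × InOneClass π e → edge⁺ (restr G π) e ≡ true
    to {e} (h , in-class) = edge⇒edge⁺ (restr G π) e (restr-edge⇐ e (edge⁺⇒edge G e h) in-class) (edge⁺⇒¬small G e h)
    from : ∀ {e} → edge⁺ (restr G π) e ≡ true → edge⁺ G e ≡ true × InOneClass π e
    from {e} h with restr-edge⇒ e (edge⁺⇒edge (restr G π) e h)
    ... | inj₁ (h' , in-class) = edge⇒edge⁺ G e h' (edge⁺⇒¬small (restr G π) e h) , in-class
    ... | inj₂ small = ⊥-elim (edge⁺⇒¬small (restr G π) e h small)

  restr-nEdges⁺-< : ¬ EdgesWithinClasses G π → nEdges⁺ (restr G π) < nEdges⁺ G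
  restr-nEdges⁺-< crossing = subst (_< nEdges⁺ G) (cong length (sym edgeList⁺-restr))
    (LP.filter-notAll (inOneClass? π) (edgeList⁺ G) (AllP.¬All⇒Any¬ (inOneClass? π) (edgeList⁺ G) crossing))

  module _ (within : EdgesWithinClasses G π) where

    restr-edgeList⁺ : edgeList⁺ (restr G π) ≡ edgeList⁺ G
    restr-edgeList⁺ = trans edgeList⁺-restr (LP.filter-all (inOneClass? π) within)

    private
      within⇒inOneClass : ∀ e → edge G e ≡ true → ¬ ∣ e ∣ ≤ 1 → InOneClass π e
      within⇒inOneClass e h ¬small = All.lookup within (∈edgeList⁺ G e (edge⇒edge⁺ G e h ¬small))

    connected⇒restr-connected-within : ∀ {i j} → Connected G i j → Connected (restr G π) i j
    connected⇒restr-connected-within = connected⇒restr-connected (λ e h ¬small → h , within⇒inOneClass e h ¬small)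

    restr-cc : cc (restr G π) ≡ cc G
    restr-cc = #classes-cong (connected-isDecEquivalence (restr G π)) (connected-isDecEquivalence G)
      (λ i j → restr-connected⇒connected , connected⇒restr-connected-within)

    restr≅ : restr G π ≅ G
    restr≅ = record { bij = ↔-id _ ; pres = λ S → trans (cong (edge G) (image-id S)) (sym (same-edges S)) }
      where
      same-edges : ∀ e → edge (restr G π) e ≡ edge G e
      same-edges e = bool-ext
        (λ h → [ proj₁ , small⇒edge G e ]′ (restr-edge⇒ e h))
        (λ h → edge-or-small h (∣ e ∣ ℕP.≤? 1))
        where
        edge-or-small : edge G e ≡ true → Dec (∣ e ∣ ≤ 1) → edge (restr G π) e ≡ true
        edge-or-small h (yes small) = small⇒edge (restr G π) e small
        edge-or-small h (no ¬small) = restr-edge⇐ e h (within⇒inOneClass e h ¬small)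

module _ (G : Hypergraph) {k} (π : Fin (size G) → Fin k) where
  open Restriction G π

  admissible×within⇔componentMap : (Admissible G π × EdgesWithinClasses G π → Components.IsClassMap G π)
                × (Components.IsClassMap G π → Admissible G π × EdgesWithinClasses G π)
  admissible×within⇔componentMap = to , from
    where
    to : Admissible G π × EdgesWithinClasses G π → Components.IsClassMap G π
    to ((surj , canon , classes-connected) , within) = surj , canon , λ i j →
        (λ eq → restr-connected⇒connected (classes-connected i j eq))
      , (λ conn → restr-connected⇒same-class (connected⇒restr-connected-within G π within conn))
    from : Components.IsClassMap G π → Admissible G π × EdgesWithinClasses G π
    from (surj , canon , ker) =
        (surj , canon , λ i j eq → connected⇒restr-connected (λ e h _ → h , in-class e h) (proj₁ (ker i j) eq))
      , All.tabulate (λ {e} e∈ → in-class e (edge⁺⇒edge G e (edgeList⁺⇒edge⁺ G e∈)))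
      where
      in-class : ∀ e → edge G e ≡ true → InOneClass π e
      in-class = same-class⇒inOneClass {r = rawEdge G} (λ {a} {b} → proj₂ (ker a b))

-- the pairs (π, F) that contribute to λ₀ ⋆ altSum once altSum is expanded over edge sets F
Compatible : (G : Hypergraph) → List (Subset (size G)) → {k : ℕ} → (Fin (size G) → Fin k) → Set
Compatible G F π = Admissible G π × All (InOneClass π) F × cc (spanning G F) ≡ cc (restr G π)

compatible? : ∀ G F {k} (π : Fin (size G) → Fin k) → Dec (Compatible G F π)
compatible? G F π = admissible? G π ×-dec (All.all? (inOneClass? π) F ×-dec (cc (spanning G F) ℕ.≟ cc (restr G π)))

module _ (G : Hypergraph) (F : List (Subset (size G))) (F⊆E : All (λ e → edge G e ≡ true) F)
         {k} (π : Fin (size G) → Fin k) where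
  open Restriction G π

  private
    H = spanning G F

    spanning⇒restr : All (InOneClass π) F → ∀ {i j} → Connected H i j → Connected (restr G π) i j
    spanning⇒restr in-class = connected⇒restr-connected λ e h ¬small →
      [ (λ e∈ → All.lookup F⊆E e∈ , All.lookup in-class e∈) , ⊥-elim ∘ ¬small ]′ (spanning-edge⇒ G F e h)

  compatible⇔componentMap : (Compatible G F π → Components.IsClassMap H π) × (Components.IsClassMap H π → Compatible G F π)
  compatible⇔componentMap = to , from
    where
    to : Compatible G F π → Components.IsClassMap H π
    to ((surj , canon , classes-connected) , in-class , cc≡) = surj , canon , λ i j →
        (λ eq → coarsening-with-#classes-≡ (connected-isDecEquivalence H) (connected-isDecEquivalence (restr G π))
                  (spanning⇒restr in-class) cc≡ (classes-connected i j eq))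
      , (λ conn → restr-connected⇒same-class (spanning⇒restr in-class conn))
    from : Components.IsClassMap H π → Compatible G F π
    from (surj , canon , ker) = (surj , canon , λ i j eq → spanning⇒restr in-class (proj₁ (ker i j) eq)) , in-class , cc≡
      where
      in-class : All (InOneClass π) F
      in-class = All.tabulate λ {e} e∈ →
        same-class⇒inOneClass {r = rawEdge H} (λ {a} {b} → proj₂ (ker a b)) e (spanning-edge⇐ G F e∈)
      cc≡ : cc H ≡ cc (restr G π)
      cc≡ = #classes-cong (connected-isDecEquivalence H) (connected-isDecEquivalence (restr G π))
        (λ i j → spanning⇒restr in-class , λ conn → proj₁ (ker i j) (restr-connected⇒same-class conn))

module Sums {c ℓ} (K : CommutativeRing c ℓ) where
  open CommutativeRing K renaming (refl to ≈-refl; sym to ≈-sym; trans to ≈-trans; reflexive to ≈-reflexive)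
  open import Relation.Binary.Reasoning.Setoid setoid

  ∑-map : List A → (A → Carrier) → Carrier
  ∑-map xs f = ∑ K (map f xs)

  syntax ∑-map xs (λ x → e) = ∑[ x ← xs ] e

  ind : Bool → Carrier → Carrier
  ind true x = x
  ind false x = 0#

  ∑-++ : ∀ xs ys → ∑ K (xs ++ ys) ≈ ∑ K xs + ∑ K ys
  ∑-++ [] ys = ≈-sym (+-identityˡ _)
  ∑-++ (x ∷ xs) ys = ≈-trans (+-congˡ (∑-++ xs ys)) (≈-sym (+-assoc _ _ _))

  ∑-cong : ∀ {f g : A → Carrier} xs → (∀ {x} → x ∈ xs → f x ≈ g x) → ∑[ x ← xs ] f x ≈ ∑[ x ← xs ] g x
  ∑-cong [] h = ≈-refl
  ∑-cong (x ∷ xs) h = +-cong (h (here refl)) (∑-cong xs (h ∘ there))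

  ∑-concatMap : ∀ (f : A → List Carrier) xs → ∑ K (concatMap f xs) ≈ ∑[ x ← xs ] ∑ K (f x)
  ∑-concatMap f [] = ≈-refl
  ∑-concatMap f (x ∷ xs) = ≈-trans (∑-++ (f x) (concatMap f xs)) (+-congˡ (∑-concatMap f xs))

  ∑-filter : {P : Pred A p} (P? : Decidable P) (f : A → Carrier) → ∀ xs →
    ∑[ x ← filter P? xs ] f x ≈ ∑[ x ← xs ] ind (does (P? x)) (f x)
  ∑-filter P? f [] = ≈-refl
  ∑-filter P? f (x ∷ xs) with P? x
  ... | yes _ = +-congˡ (∑-filter P? f xs)
  ... | no _ = ≈-trans (∑-filter P? f xs) (≈-sym (+-identityˡ _))

  ∑-0 : ∀ (xs : List A) → ∑[ _ ← xs ] 0# ≈ 0#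
  ∑-0 [] = ≈-refl
  ∑-0 (x ∷ xs) = ≈-trans (+-identityˡ _) (∑-0 xs)

  ∑-+ : ∀ (f g : A → Carrier) xs → ∑[ x ← xs ] (f x + g x) ≈ ∑[ x ← xs ] f x + ∑[ x ← xs ] g x
  ∑-+ f g [] = ≈-sym (+-identityˡ _)
  ∑-+ f g (x ∷ xs) = begin
    (f x + g x) + ∑[ x ← xs ] (f x + g x)          ≈⟨ +-congˡ (∑-+ f g xs) ⟩
    (f x + g x) + (∑-map xs f + ∑-map xs g)        ≈⟨ +-assoc _ _ _ ⟩
    f x + (g x + (∑-map xs f + ∑-map xs g))        ≈⟨ +-congˡ (+-assoc _ _ _) ⟨
    f x + ((g x + ∑-map xs f) + ∑-map xs g)        ≈⟨ +-congˡ (+-congʳ (+-comm _ _)) ⟩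
    f x + ((∑-map xs f + g x) + ∑-map xs g)        ≈⟨ +-congˡ (+-assoc _ _ _) ⟩
    f x + (∑-map xs f + (g x + ∑-map xs g))        ≈⟨ +-assoc _ _ _ ⟨
    (f x + ∑-map xs f) + (g x + ∑-map xs g)        ∎

  ∑-swap : ∀ (f : A → B → Carrier) xs ys → ∑[ x ← xs ] ∑[ y ← ys ] f x y ≈ ∑[ y ← ys ] ∑[ x ← xs ] f x y
  ∑-swap f [] ys = ≈-sym (∑-0 ys)
  ∑-swap f (x ∷ xs) ys = ≈-trans (+-congˡ (∑-swap f xs ys)) (≈-sym (∑-+ (f x) (λ y → ∑[ x ← xs ] f x y) ys))

  ∑-*ˡ : ∀ (f : A → Carrier) a xs → ∑[ x ← xs ] (a * f x) ≈ a * ∑[ x ← xs ] f x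
  ∑-*ˡ f a [] = ≈-sym (zeroʳ a)
  ∑-*ˡ f a (x ∷ xs) = ≈-trans (+-congˡ (∑-*ˡ f a xs)) (≈-sym (distribˡ a _ _))

  ∑-ind-count : {P : Pred A p} (P? : Decidable P) → ∀ a xs → ∑[ x ← xs ] ind (does (P? x)) a ≈ ℕ→K K (count P? xs) * a
  ∑-ind-count P? a [] = ≈-sym (zeroˡ a)
  ∑-ind-count P? a (x ∷ xs) with P? x
  ... | yes _ = ≈-trans (+-congˡ (∑-ind-count P? a xs)) (≈-trans (+-congʳ (≈-sym (*-identityˡ a))) (≈-sym (distribʳ a _ _)))
  ... | no _ = ≈-trans (+-identityˡ _) (∑-ind-count P? a xs)

  ℕ→K-1 : ∀ a → ℕ→K K 1 * a ≈ a
  ℕ→K-1 a = ≈-trans (*-congʳ (+-identityʳ 1#)) (*-identityˡ a)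

  ∑-ind-unique : {P : Pred A p} (P? : Decidable P) → ∀ a xs → count P? xs ≡ 1 → ∑[ x ← xs ] ind (does (P? x)) a ≈ a
  ∑-ind-unique P? a xs one =
    ≈-trans (∑-ind-count P? a xs) (≈-trans (≈-reflexive (cong (λ m → ℕ→K K m * a) one)) (ℕ→K-1 a))

  ind-cong : ∀ b {x y} → x ≈ y → ind b x ≈ ind b y
  ind-cong true x≈y = x≈y
  ind-cong false _ = ≈-refl

  ind-dec-cong : {P : Set p} (d : Dec P) → ∀ {x y} → (P → x ≈ y) → ind (does d) x ≈ ind (does d) y
  ind-dec-cong (yes p) h = h p
  ind-dec-cong (no _) h = ≈-refl

  ind-∑ : ∀ b (f : A → Carrier) xs → ind b (∑[ x ← xs ] f x) ≈ ∑[ x ← xs ] ind b (f x)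
  ind-∑ true f xs = ≈-refl
  ind-∑ false f xs = ≈-sym (∑-0 xs)

  ind-∧ : ∀ b b' x → ind (b ∧ b') x ≡ ind b (ind b' x)
  ind-∧ true b' x = refl
  ind-∧ false b' x = refl

  ind-split : ∀ b b' x → ind b x ≈ ind (b ∧ b') x + ind (b ∧ not b') x
  ind-split true true x = ≈-sym (+-identityʳ x)
  ind-split true false x = ≈-sym (+-identityˡ x)
  ind-split false b' x = ≈-sym (+-identityˡ 0#)

  ∑-maps : ∀ n → ((k : ℕ) → (Fin n → Fin k) → Carrier) → Carrier
  ∑-maps n f = ∑[ k ← upTo (suc n) ] ∑[ π ← allFuns n k ] f k π

  ∑-maps-cong : ∀ n {f g : (k : ℕ) → (Fin n → Fin k) → Carrier} →
    (∀ k π → f k π ≈ g k π) → ∑-maps n f ≈ ∑-maps n g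
  ∑-maps-cong n h = ∑-cong (upTo (suc n)) (λ {k} _ → ∑-cong (allFuns n k) (λ _ → h k _))

  ∑-maps-+ : ∀ n f g → ∑-maps n (λ k π → f k π + g k π) ≈ ∑-maps n f + ∑-maps n g
  ∑-maps-+ n f g = ≈-trans (∑-cong (upTo (suc n)) (λ {k} _ → ∑-+ (f k) (g k) (allFuns n k)))
    (∑-+ (λ k → ∑[ π ← allFuns n k ] f k π) (λ k → ∑[ π ← allFuns n k ] g k π) (upTo (suc n)))

  ∑-maps-swap : ∀ n (f : (k : ℕ) → (Fin n → Fin k) → A → Carrier) xs →
    ∑-maps n (λ k π → ∑[ x ← xs ] f k π x) ≈ ∑[ x ← xs ] ∑-maps n (λ k π → f k π x)
  ∑-maps-swap n f xs = ≈-trans (∑-cong (upTo (suc n)) (λ {k} _ → ∑-swap (f k) (allFuns n k) xs))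
    (∑-swap (λ k x → ∑[ π ← allFuns n k ] f k π x) (upTo (suc n)) xs)

  ∑-maps-classMap : ∀ {n} {_∼_ : Rel (Fin n) r} (d : IsDecEquivalence _∼_) →
    (Q : (k : ℕ) → (Fin n → Fin k) → Set q) (Q? : ∀ k π → Dec (Q k π)) →
    (∀ k π → (Q k π → Classes.IsClassMap d π) × (Classes.IsClassMap d π → Q k π)) →
    ∀ x → ∑-maps n (λ k π → ind (does (Q? k π)) x) ≈ x
  ∑-maps-classMap {n = n} d Q Q? Q⇔ x = begin
    ∑-maps n (λ k π → ind (does (Q? k π)) x)
      ≈⟨ ∑-cong (upTo (suc n)) (λ {k} _ → at-size k (k ℕ.≟ #classes)) ⟩
    ∑[ k ← upTo (suc n) ] ind (does (k ℕ.≟ #classes)) x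
      ≈⟨ ∑-ind-unique (ℕ._≟ #classes) x (upTo (suc n)) one-size ⟩
    x ∎
    where
    open Classes d
    one-size : count (ℕ._≟ #classes) (upTo (suc n)) ≡ 1
    one-size = count-≡1 (ℕ._≟ #classes) (upTo (suc n)) (UniqueP.upTo⁺ (suc n)) (λ a b → trans a (sym b))
                 (∈-upTo⁺ (s≤s (#classes≤n d))) refl
    at-size : ∀ k (d : Dec (k ≡ #classes)) → ∑[ π ← allFuns n k ] ind (does (Q? k π)) x ≈ ind (does d) x
    at-size k (no k≢#) = ≈-trans (∑-ind-count (Q? k) x (allFuns n k))
      (≈-trans (*-congʳ (≈-reflexive (cong (ℕ→K K)
                 (count-≡0 (Q? k) (allFuns n k) (λ _ q → k≢# (classMap-size (proj₁ (Q⇔ k _) q)))))))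
               (zeroˡ x))
    at-size _ (yes refl) = ∑-ind-unique (Q? #classes) x (allFuns n #classes) (trans
      (count-cong (Q? #classes) (_≗? classIndex) (allFuns n #classes)
        (λ _ → (λ q → classMap≗classIndex (proj₁ (Q⇔ #classes _) q))
             , (λ eq → proj₂ (Q⇔ #classes _) (≗classIndex⇒classMap eq))))
      (allFuns-complete n #classes classIndex))

module AlternatingSums {c ℓ} (K : CommutativeRing c ℓ) where
  open CommutativeRing K renaming (refl to ≈-refl; sym to ≈-sym; trans to ≈-trans; reflexive to ≈-reflexive)
  open import Relation.Binary.Reasoning.Setoid setoid
  open import Algebra.Properties.Ring ring using (-1*x≈-x)
  open Sums K

  private
    *-ind-1 : ∀ a b → a * ind b 1# ≈ ind b a
    *-ind-1 a true = *-identityʳ a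
    *-ind-1 a false = zeroʳ a

    ∑-upTo-point : ∀ (f : ℕ → Carrier) {m w} → w ≤ m → ∑[ j ← upTo (suc m) ] ind (does (w ℕ.≟ j)) (f j) ≈ f w
    ∑-upTo-point f {m} {w} w≤m = begin
      ∑[ j ← upTo (suc m) ] ind (does (w ℕ.≟ j)) (f j)
        ≈⟨ ∑-cong (upTo (suc m)) (λ {j} _ → ind-dec-cong (w ℕ.≟ j) (λ w≡j → ≈-reflexive (cong f (sym w≡j)))) ⟩
      ∑[ j ← upTo (suc m) ] ind (does (w ℕ.≟ j)) (f w)
        ≈⟨ ∑-ind-unique (w ℕ.≟_) (f w) (upTo (suc m)) (count-≡1 (w ℕ.≟_) (upTo (suc m)) (UniqueP.upTo⁺ (suc m))
             (λ a b → trans (sym a) b) (∈-upTo⁺ (s≤s w≤m)) refl) ⟩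
      f w ∎

  ∑-sgn-count : ∀ {X : Set a} {C : Pred X p} (c? : Decidable C) (w : X → ℕ) m (S : List X) →
    (∀ {x} → x ∈ S → w x ≤ m) →
    ∑[ j ← upTo (suc m) ] (sgn K j * ℕ→K K (count (λ x → c? x ×-dec (w x ℕ.≟ j)) S))
      ≈ ∑[ x ← S ] ind (does (c? x)) (sgn K (w x))
  ∑-sgn-count c? w m S w≤m = begin
    ∑[ j ← upTo (suc m) ] (sgn K j * ℕ→K K (count (selected j) S))
      ≈⟨ ∑-cong (upTo (suc m)) (λ {j} _ →
           *-congˡ (≈-trans (≈-sym (*-identityʳ _)) (≈-sym (∑-ind-count (selected j) 1# S)))) ⟩
    ∑[ j ← upTo (suc m) ] (sgn K j * ∑[ x ← S ] ind (does (selected j x)) 1#)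
      ≈⟨ ∑-cong (upTo (suc m)) (λ {j} _ → ≈-sym (∑-*ˡ (λ x → ind (does (selected j x)) 1#) (sgn K j) S)) ⟩
    ∑[ j ← upTo (suc m) ] ∑[ x ← S ] (sgn K j * ind (does (selected j x)) 1#)
      ≈⟨ ∑-swap (λ j x → sgn K j * ind (does (selected j x)) 1#) (upTo (suc m)) S ⟩
    ∑[ x ← S ] ∑[ j ← upTo (suc m) ] (sgn K j * ind (does (selected j x)) 1#)
      ≈⟨ ∑-cong S (λ {x} x∈ → per-element x (w≤m x∈)) ⟩
    ∑[ x ← S ] ind (does (c? x)) (sgn K (w x))
      ∎
    where
    selected : ∀ j → Decidable _
    selected j x = c? x ×-dec (w x ℕ.≟ j)
    per-element : ∀ x → w x ≤ m →
      ∑[ j ← upTo (suc m) ] (sgn K j * ind (does (selected j x)) 1#) ≈ ind (does (c? x)) (sgn K (w x))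
    per-element x w≤m = begin
      ∑[ j ← upTo (suc m) ] (sgn K j * ind (does (selected j x)) 1#)
        ≈⟨ ∑-cong (upTo (suc m)) (λ {j} _ → ≈-trans (*-ind-1 (sgn K j) (does (selected j x)))
             (≈-reflexive (ind-∧ (does (c? x)) (does (w x ℕ.≟ j)) (sgn K j)))) ⟩
      ∑[ j ← upTo (suc m) ] ind (does (c? x)) (ind (does (w x ℕ.≟ j)) (sgn K j))
        ≈⟨ ind-∑ (does (c? x)) (λ j → ind (does (w x ℕ.≟ j)) (sgn K j)) (upTo (suc m)) ⟨
      ind (does (c? x)) (∑[ j ← upTo (suc m) ] ind (does (w x ℕ.≟ j)) (sgn K j))
        ≈⟨ ind-cong (does (c? x)) (∑-upTo-point (sgn K) w≤m) ⟩
      ind (does (c? x)) (sgn K (w x))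
        ∎

  ∑-sgn-sublists-∷ : ∀ (x : A) xs → ∑[ F ← sublists (x ∷ xs) ] sgn K (length F) ≈ 0#
  ∑-sgn-sublists-∷ x xs = begin
    ∑ K (map s (map (x ∷_) S ++ S))                  ≡⟨ cong (∑ K) (LP.map-++ s (map (x ∷_) S) S) ⟩
    ∑ K (map s (map (x ∷_) S) ++ map s S)            ≈⟨ ∑-++ (map s (map (x ∷_) S)) (map s S) ⟩
    ∑ K (map s (map (x ∷_) S)) + ∑-map S s           ≡⟨ cong (λ ys → ∑ K ys + ∑-map S s) (LP.map-∘ S) ⟨
    ∑[ F ← S ] (- 1# * s F) + ∑-map S s              ≈⟨ +-congʳ (∑-*ˡ s (- 1#) S) ⟩
    - 1# * ∑-map S s + ∑-map S s                     ≈⟨ +-congʳ (-1*x≈-x _) ⟩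
    - ∑-map S s + ∑-map S s                          ≈⟨ -‿inverseˡ _ ⟩
    0#                                               ∎
    where
    S = sublists xs
    s : List A → Carrier
    s F = sgn K (length F)

  ∑-sgn-sublists-edgeList⁺ : ∀ G → ∑[ F ← sublists (edgeList⁺ G) ] sgn K (length F) ≈ εδ K G
  ∑-sgn-sublists-edgeList⁺ G with anySubset? (λ S → edge⁺ G S B.≟ true)
  ... | yes (S , e⁺) with edgeList⁺ G | ∈edgeList⁺ G S e⁺
  ...   | x ∷ xs | _ = ∑-sgn-sublists-∷ x xs
  ∑-sgn-sublists-edgeList⁺ G | no ∄e⁺ with edgeList⁺ G
    | LP.filter-none (λ S → edge⁺ G S B.≟ true) {xs = allSubsets (size G)} (All.tabulate λ {S} _ e⁺ → ∄e⁺ (S , e⁺))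
  ... | [] | _ = +-identityʳ 1#

  altSum-as-∑-edgeSets : ∀ G → altSum K G ≈
    ∑[ F ← sublists (edgeList⁺ G) ] ind (does (cc (spanning G F) ℕ.≟ cc G)) (sgn K (length F))
  altSum-as-∑-edgeSets G = ≈-trans
    (∑-sgn-count (λ F → cc (spanning G F) ℕ.≟ cc G) (λ F → nEdges⁺ (spanning G F)) (nEdges⁺ G) (sublists (edgeList⁺ G))
      (λ F∈ → subst (_≤ nEdges⁺ G) (sym (nEdges⁺≡length F∈))
                (SublistP.length-mono-≤ (sublists⇒⊆ (edgeList⁺ G) F∈))))
    (∑-cong (sublists (edgeList⁺ G)) λ {F} F∈ →
      ≈-reflexive (cong (λ m → ind (does (cc (spanning G F) ℕ.≟ cc G)) (sgn K m)) (nEdges⁺≡length F∈)))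
    where
    nEdges⁺≡length : ∀ {F} → F ∈ sublists (edgeList⁺ G) → nEdges⁺ (spanning G F) ≡ length F
    nEdges⁺≡length F∈ = let F⊆E⁺ = sublists⇒⊆ (edgeList⁺ G) F∈ in
      nEdges⁺-spanning G _ (Unique-resp-⊇ F⊆E⁺ (edgeList⁺-unique G))
        (All.tabulate (edgeList⁺⇒edge⁺ G ∘ SublistP.Any-resp-⊆ F⊆E⁺))

  altSum-restr : ∀ G {k} (π : Fin (size G) → Fin k) → EdgesWithinClasses G π → altSum K (restr G π) ≡ altSum K G
  altSum-restr G π within = cong₂ altSum-from (restr-edgeList⁺ G π within) (restr-cc G π within)
    where
    altSum-from : List (Subset (size G)) → ℕ → Carrier
    altSum-from E i = ∑[ j ← upTo (suc (length E)) ]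
      (sgn K j * ℕ→K K (length (filter (λ F → (cc (spanning G F) ℕ.≟ i) ×-dec (nEdges⁺ (spanning G F) ℕ.≟ j))
                                       (sublists E))))

module InverseOfλ₀ {c ℓ} (K : CommutativeRing c ℓ) where
  open CommutativeRing K renaming (refl to ≈-refl; sym to ≈-sym; trans to ≈-trans; reflexive to ≈-reflexive)
  open import Relation.Binary.Reasoning.Setoid setoid
  open import Algebra.Properties.Ring ring using (+-cancelʳ)
  open Sums K
  open AlternatingSums K

  conv-as-∑-maps : ∀ ζ ζ' G →
    conv K ζ ζ' G ≈ ∑-maps (size G) (λ k π → ind (does (admissible? G π)) (ζ (quot G π) * ζ' (restr G π)))
  conv-as-∑-maps ζ ζ' G = ≈-trans
    (∑-concatMap (λ k → map term (filter (admissible? G) (allFuns (size G) k))) (upTo (suc (size G))))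
    (∑-cong (upTo (suc (size G))) λ {k} _ → ∑-filter (admissible? G) term (allFuns (size G) k))
    where
    term : ∀ {k} → (Fin (size G) → Fin k) → Carrier
    term π = ζ (quot G π) * ζ' (restr G π)

  λ₀⋆altSum-term : ∀ G {k} (π : Fin (size G) → Fin k) →
    ind (does (admissible? G π)) (1# * altSum K (restr G π))
      ≈ ∑[ F ← sublists (edgeList⁺ G) ] ind (does (compatible? G F π)) (sgn K (length F))
  λ₀⋆altSum-term G π = begin
    ind adm (1# * altSum K (restr G π))
      ≈⟨ ind-cong adm (≈-trans (*-identityˡ _) (altSum-as-∑-edgeSets (restr G π))) ⟩
    ind adm (∑[ F ← sublists (edgeList⁺ (restr G π)) ] term F)
      ≡⟨ cong (λ Fs → ind adm (∑-map Fs term))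
           (trans (cong sublists (edgeList⁺-restr G π)) (sublists-filter (inOneClass? π) (edgeList⁺ G))) ⟩
    ind adm (∑[ F ← filter (All.all? (inOneClass? π)) (sublists (edgeList⁺ G)) ] term F)
      ≈⟨ ind-cong adm (∑-filter (All.all? (inOneClass? π)) term (sublists (edgeList⁺ G))) ⟩
    ind adm (∑[ F ← sublists (edgeList⁺ G) ] ind (does (All.all? (inOneClass? π) F)) (term F))
      ≈⟨ ind-∑ adm _ (sublists (edgeList⁺ G)) ⟩
    ∑[ F ← sublists (edgeList⁺ G) ] ind adm (ind (does (All.all? (inOneClass? π) F)) (term F))
      ≈⟨ ∑-cong (sublists (edgeList⁺ G)) (λ {F} _ → ≈-reflexive (sym
           (trans (ind-∧ adm (all-in F ∧ cc≡ F) (sgn K (length F)))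
                  (cong (ind adm) (ind-∧ (all-in F) (cc≡ F) (sgn K (length F))))))) ⟩
    ∑[ F ← sublists (edgeList⁺ G) ] ind (does (compatible? G F π)) (sgn K (length F))
      ∎
    where
    adm = does (admissible? G π)
    all-in cc≡ : List (Subset (size G)) → Bool
    all-in F = does (All.all? (inOneClass? π) F)
    cc≡ F = does (cc (spanning G F) ℕ.≟ cc (restr G π))
    term : List (Subset (size G)) → Carrier
    term F = ind (cc≡ F) (sgn K (length F))

  -- Exchanging the sums leaves, for each edge set F, one surviving π: the components of (V, F).
  λ₀⋆altSum≈εδ : ∀ G → conv K (λ₀ K) (altSum K) G ≈ εδ K G
  λ₀⋆altSum≈εδ G = begin
    conv K (λ₀ K) (altSum K) G
      ≈⟨ conv-as-∑-maps (λ₀ K) (altSum K) G ⟩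
    ∑-maps n (λ k π → ind (does (admissible? G π)) (1# * altSum K (restr G π)))
      ≈⟨ ∑-maps-cong n (λ k π → λ₀⋆altSum-term G π) ⟩
    ∑-maps n (λ k π → ∑[ F ← Fs ] ind (does (compatible? G F π)) (sgn K (length F)))
      ≈⟨ ∑-maps-swap n (λ k π F → ind (does (compatible? G F π)) (sgn K (length F))) Fs ⟩
    ∑[ F ← Fs ] ∑-maps n (λ k π → ind (does (compatible? G F π)) (sgn K (length F)))
      ≈⟨ ∑-cong Fs (λ {F} F∈ → ∑-maps-classMap (connected-isDecEquivalence (spanning G F))
           (λ k π → Compatible G F π) (λ k π → compatible? G F π)
           (λ k → compatible⇔componentMap G F (edges F∈)) (sgn K (length F))) ⟩
    ∑[ F ← Fs ] sgn K (length F)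
      ≈⟨ ∑-sgn-sublists-edgeList⁺ G ⟩
    εδ K G
      ∎
    where
    n = size G
    Fs = sublists (edgeList⁺ G)
    edges : ∀ {F} → F ∈ Fs → All (λ e → edge G e ≡ true) F
    edges F∈ =
      All.tabulate (edge⁺⇒edge G _ ∘ edgeList⁺⇒edge⁺ G ∘ SublistP.Any-resp-⊆ (sublists⇒⊆ (edgeList⁺ G) F∈))

  RestrictionInvariant : (Hypergraph → Carrier) → Set ℓ
  RestrictionInvariant ζ = ∀ G {k} (π : Fin (size G) → Fin k) → EdgesWithinClasses G π → ζ (restr G π) ≈ ζ G

  character⇒restrictionInvariant : ∀ {ζ} → IsCharacter K ζ → RestrictionInvariant ζ
  character⇒restrictionInvariant isCharacter G π within = IsCharacter.iso-inv isCharacter (restr≅ G π within)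

  altSum-restrictionInvariant : RestrictionInvariant (altSum K)
  altSum-restrictionInvariant G π within = ≈-reflexive (altSum-restr G π within)

  -- The only admissible π with every edge inside a class is the partition into connected components.
  private
    crossing-part : (Hypergraph → Carrier) → Hypergraph → Carrier
    crossing-part ζ G = ∑-maps (size G) λ k π →
      ind (does (admissible? G π ×-dec ¬? (withinClasses? G π))) (1# * ζ (restr G π))

  λ₀⋆-split : ∀ {ζ} → RestrictionInvariant ζ → ∀ G → conv K (λ₀ K) ζ G ≈ ζ G + crossing-part ζ G
  λ₀⋆-split {ζ} invariant G = begin
    conv K (λ₀ K) ζ G
      ≈⟨ conv-as-∑-maps (λ₀ K) ζ G ⟩
    ∑-maps n (λ k π → ind (does (admissible? G π)) (term π))
      ≈⟨ ∑-maps-cong n (λ k π → ind-split (does (admissible? G π)) (does (withinClasses? G π)) (term π)) ⟩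
    ∑-maps n (λ k π → within k π + crossing k π)
      ≈⟨ ∑-maps-+ n within crossing ⟩
    ∑-maps n within + crossing-part ζ G
      ≈⟨ +-congʳ (∑-maps-cong n λ k π →
           ind-dec-cong (within? π) (λ (_ , w) → ≈-trans (*-identityˡ _) (invariant G π w))) ⟩
    ∑-maps n (λ k π → ind (does (within? π)) (ζ G)) + crossing-part ζ G
      ≈⟨ +-congʳ (∑-maps-classMap (connected-isDecEquivalence G) _ (λ k → within?)
           (λ k → admissible×within⇔componentMap G) (ζ G)) ⟩
    ζ G + crossing-part ζ G
      ∎
    where
    n = size G
    term : ∀ {k} → (Fin n → Fin k) → Carrier
    term π = 1# * ζ (restr G π)
    within? : ∀ {k} (π : Fin n → Fin k) → Dec (Admissible G π × EdgesWithinClasses G π)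
    within? π = admissible? G π ×-dec withinClasses? G π
    within crossing : (k : ℕ) → (Fin n → Fin k) → Carrier
    within k π = ind (does (within? π)) (term π)
    crossing k π = ind (does (admissible? G π ×-dec ¬? (withinClasses? G π))) (term π)

  λ₀⋆-injective : ∀ {ζ ζ'} → RestrictionInvariant ζ → RestrictionInvariant ζ' →
    (∀ G → conv K (λ₀ K) ζ G ≈ conv K (λ₀ K) ζ' G) → ∀ G → ζ G ≈ ζ' G
  λ₀⋆-injective {ζ} {ζ'} invariant invariant' same G = below (suc (nEdges⁺ G)) G ℕP.≤-refl
    where
    below : ∀ m G → nEdges⁺ G < m → ζ G ≈ ζ' G
    below (suc m) G G<m = +-cancelʳ _ _ _ (begin
      ζ G + crossing-part ζ G     ≈⟨ λ₀⋆-split invariant G ⟨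
      conv K (λ₀ K) ζ G           ≈⟨ same G ⟩
      conv K (λ₀ K) ζ' G          ≈⟨ λ₀⋆-split invariant' G ⟩
      ζ' G + crossing-part ζ' G   ≈⟨ +-congˡ (∑-maps-cong (size G) λ k π →
                                       ind-dec-cong (admissible? G π ×-dec ¬? (withinClasses? G π)) λ (_ , crossing) →
                                         *-congˡ (≈-sym (below m (restr G π)
                                           (ℕP.<-≤-trans (restr-nEdges⁺-< G π crossing) (ℕP.≤-pred G<m))))) ⟩
      ζ' G + crossing-part ζ G    ∎)

lemma2p17 : ∀ {c ℓ} (K : CommutativeRing c ℓ) → IsField K → CharZero K →
    (λ⊂ : Hypergraph → CommutativeRing.Carrier K) → IsCharacter K λ⊂ →
    (∀ G → CommutativeRing._≈_ K (conv K (λ₀ K) λ⊂ G) (εδ K G)) →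
    (∀ G → CommutativeRing._≈_ K (conv K λ⊂ (λ₀ K) G) (εδ K G)) →
    ∀ G → CommutativeRing._≈_ K (λ⊂ G) (altSum K G)
lemma2p17 K _ _ λ⊂ isCharacter λ₀⋆λ⊂≈εδ _ =
  λ₀⋆-injective (character⇒restrictionInvariant isCharacter) altSum-restrictionInvariant
    (λ G → ≈-trans (λ₀⋆λ⊂≈εδ G) (≈-sym (λ₀⋆altSum≈εδ G)))
  where
  open CommutativeRing K using () renaming (trans to ≈-trans; sym to ≈-sym)
  open InverseOfλ₀ K
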